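{- Let $G=(\mathcal V,E)$ be a $d$-dimensional subset partition graph on a finite symbol set $S$ satisfying the singleton property, with maximum degree $\Delta$, and let $r\ge\lceil16e\Delta\rceil$. Let $G'$ be the random subset partition graph on $S\times[r]$ obtained from $G$ by the random interpolation construction described in the context, with $\mathcal A'$ the set of all sets appearing in vertices of $G'$. Then with positive probability the following holds: for all $A,A'\in\mathcal A'$ with $|A\cap A'|=rd-1$, $A$ and $A'$ are contained in adjacent vertices of $G'$.
   Context: A $d$-dimensional subset partition graph (SPG) on a finite symbol set $S$ is a connected undirected graph $G=(\mathcal V,E)$ whose vertex set is a partition of some $\mathcal A\subseteq\binom{S}{d}$ into non-empty parts; it has the singleton property if every vertex is a single set, so we write vertices as $\{A\}$. Random interpolation construction with parameter $r$: for a set $B\subseteq S\times[r]$ and $i\in[r]$, its $i$-th row is $B|_i=\{x\in S:(x,i)\in B\}$. Each vertex $\{A\}$ of $G$ is replaced by the vertex $\{A\times[r]\}$. For each edge between $\{A\}$ and $\{A'\}$ of $G$ (with a fixed orientation from $A$ to $A'$), set $k=d-|A\cap A'|$, choose a permutation $\pi$ of $[r]$ uniformly at random, independently for each edge, and replace the edge by a path of length $rk$ from $\{A\times[r]\}$ to $\{A'\times[r]\}$ consisting of $r$ consecutive segments of $k$ edges each; along each edge of the $j$-th segment, the current set is modified by removing one element of $(A\setminus A')\times\{\pi(j)\}$ and adding one element of $(A'\setminus A)\times\{\pi(j)\}$ (in an arbitrary order within the row). Each intermediate vertex of the path is the singleton containing the current set. The resulting graph $G'$ is an $rd$-dimensional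 SPG on $S\times[r]$ with the singleton property. -}

module Defs where

open import Data.Nat using (ℕ; zero; suc; _+_; _*_; _≤_; _≥_; _⊔_)
open import Data.Nat using (_!)
open import Data.Nat.ListAction using (sum)
open import Data.Bool using (Bool; true; false; if_then_else_; _∧_)
open import Data.Fin using (Fin; toℕ)
open import Data.Fin.Properties using () renaming (_≟_ to _≟ᶠ_)
open import Data.Fin.Permutation using (Permutation′; _⟨$⟩ʳ_)
open import Data.List using (List; []; _∷_; map; allFin; foldr; zip; scanl; concatMap; drop)
open import Data.List.Membership.Propositional using (_∈_)
open import Data.List.Relation.Unary.Any using (Any)
open import Data.List.Relation.Unary.Unique.Propositional using (Unique)
open import Data.Product using (Σ; ∃; _×_; _,_; proj₁; proj₂)
open import Data.Sum using (_⊎_)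
open import Function.Bundles using (_⇔_)
open import Relation.Binary.PropositionalEquality using (_≡_)
open import Relation.Nullary.Decidable using (⌊_⌋)

-- Finite sets of symbols.  The symbol set S is Fin s.
-- A subset of S is a Boolean predicate Fin s → Bool;
-- a subset of S × [r] is a predicate Fin s → Fin r → Bool.

Sub : ℕ → Set
Sub s = Fin s → Bool

Sub₂ : ℕ → ℕ → Set
Sub₂ s r = Fin s → Fin r → Bool

count : ∀ {n} → (Fin n → Bool) → ℕ
count {n} f = sum (map (λ x → if f x then 1 else 0) (allFin n))

card : ∀ {s} → Sub s → ℕ
card = count

card₂ : ∀ {s r} → Sub₂ s r → ℕ
card₂ {s} {r} X = sum (map (λ x → count (X x)) (allFin s))

_∩₂_ : ∀ {s r} → Sub₂ s r → Sub₂ s r → Sub₂ s r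
(X ∩₂ Y) x i = X x i ∧ Y x i

_≐_ : ∀ {s r} → Sub₂ s r → Sub₂ s r → Set
X ≐ Y = ∀ x i → X x i ≡ Y x i

lift : ∀ {s} r → Sub s → Sub₂ s r
lift r A x i = A x

-- A graph whose vertices (Fin m) are labelled by subsets of S.
-- (Under the singleton property every vertex of an SPG is a single set.)

record LGraph (s : ℕ) : Set where
  field
    m    : ℕ
    vset : Fin m → Sub s
    adj  : Fin m → Fin m → Bool

open LGraph public

data Reach {s} (G : LGraph s) : Fin (m G) → Fin (m G) → Set where
  here : ∀ {u} → Reach G u u
  step : ∀ {u v w} → adj G u v ≡ true → Reach G v w → Reach G u w

record IsSingletonSPG {s} (d : ℕ) (G : LGraph s) : Set where
  field
    dimension  : ∀ v → card (vset G v) ≡ d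
    distinct   : ∀ u v → (∀ x → vset G u x ≡ vset G v x) → u ≡ v
    symmetric  : ∀ u v → adj G u v ≡ adj G v u
    irreflexive : ∀ v → adj G v v ≡ false
    connected  : ∀ u v → Reach G u v

degree : ∀ {s} (G : LGraph s) → Fin (m G) → ℕ
degree G v = count (adj G v)

maxDegree : ∀ {s} → LGraph s → ℕ
maxDegree G = foldr _⊔_ 0 (map (degree G) (allFin (m G)))

-- The bound r ≥ ⌈16 e Δ⌉ without real numbers.
-- T n = Σ_{k=0}^{n} n!/k!, so that the partial sum of e is T n / n!.
-- u n = (n · T n + 1) / (n · n!) = Σ_{k≤n} 1/k! + 1/(n·n!) is a strictly
-- decreasing sequence of upper bounds of e converging to e (n ≥ 1).
-- For natural r: r ≥ ⌈16eΔ⌉ ⇔ r ≥ 16eΔ ⇔ (e irrational) r > 16eΔ or Δ = 0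
-- ⇔ ∃ n ≥ 1, 16 Δ u n ≤ r.

T : ℕ → ℕ
T zero    = 1
T (suc n) = suc n * T n + 1

CeilBound : (r Δ : ℕ) → Set
CeilBound r Δ = Σ ℕ λ n → (1 ≤ n) × (16 * Δ * (n * T n + 1) ≤ r * (n * (n !)))

IsOrientation : ∀ {s} (G : LGraph s) → (Fin (m G) → Fin (m G) → Bool) → Set
IsOrientation G dir = ∀ u v → adj G u v ≡ true → dir u v ≡ true ⇔ dir v u ≡ false

Enumerates : ∀ {s} → List (Fin s) → Sub s → Sub s → Set
Enumerates {s} L A A' = Unique L × (∀ (x : Fin s) → (x ∈ L) ⇔ (A x ≡ true × A' x ≡ false))

-- Order choices: for an oriented edge u → v, the permutation π of that
-- edge and a segment index j, a pair (removal order, addition order).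
OrderChoice : ∀ {s} → LGraph s → ℕ → Set
OrderChoice {s} G r = Fin (m G) → Fin (m G) → Permutation′ r → Fin r → List (Fin s) × List (Fin s)

ValidOrders : ∀ {s r} (G : LGraph s) → (Fin (m G) → Fin (m G) → Bool) → OrderChoice G r → Set
ValidOrders {s} {r} G dir ord =
  ∀ u v → adj G u v ≡ true → dir u v ≡ true → ∀ (π : Permutation′ r) (j : Fin r) →
    Enumerates (proj₁ (ord u v π j)) (vset G u) (vset G v) ×
    Enumerates (proj₂ (ord u v π j)) (vset G v) (vset G u)

update : ∀ {s r} → Sub₂ s r → Fin s → Fin r → Bool → Sub₂ s r
update X x i b y l = if ⌊ y ≟ᶠ x ⌋ ∧ ⌊ l ≟ᶠ i ⌋ then b else X y l

-- one edge of a path: remove (a,ρ), add (b,ρ)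
stepSet : ∀ {s r} → Sub₂ s r → Fin r × Fin s × Fin s → Sub₂ s r
stepSet X (ρ , a , b) = update (update X a ρ false) b ρ true

steps : ∀ {s r} (G : LGraph s) → OrderChoice G r → Fin (m G) → Fin (m G) →
        Permutation′ r → List (Fin r × Fin s × Fin s)
steps {s} {r} G ord u v π =
  concatMap (λ j → map (λ ab → (π ⟨$⟩ʳ j) , ab) (zip (proj₁ (ord u v π j)) (proj₂ (ord u v π j))))
            (allFin r)

pathSets : ∀ {s r} (G : LGraph s) → OrderChoice G r → Fin (m G) → Fin (m G) →
           Permutation′ r → List (Sub₂ s r)
pathSets {s} {r} G ord u v π = scanl stepSet (lift r (vset G u)) (steps G ord u v π)

PermChoice : ∀ {s} → LGraph s → ℕ → Set
PermChoice G r = Fin (m G) → Fin (m G) → Permutation′ r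

InA' : ∀ {s r} (G : LGraph s) (dir : Fin (m G) → Fin (m G) → Bool) →
       OrderChoice G r → PermChoice G r → Sub₂ s r → Set
InA' {s} {r} G dir ord Π X =
  (∃ λ u → X ≐ lift r (vset G u)) ⊎
  (∃ λ u → ∃ λ v → adj G u v ≡ true × dir u v ≡ true ×
     Any (λ P → X ≐ P) (pathSets G ord u v (Π u v)))

-- adjacency in G' (vertices are singletons, identified with their sets)
Adj' : ∀ {s r} (G : LGraph s) (dir : Fin (m G) → Fin (m G) → Bool) →
       OrderChoice G r → PermChoice G r → Sub₂ s r → Sub₂ s r → Set
Adj' {s} {r} G dir ord Π X Y =
  ∃ λ u → ∃ λ v → adj G u v ≡ true × dir u v ≡ true ×
    Any (λ PQ → (X ≐ proj₁ PQ × Y ≐ proj₂ PQ) ⊎ (X ≐ proj₂ PQ × Y ≐ proj₁ PQ))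
        (zip (pathSets G ord u v (Π u v)) (drop 1 (pathSets G ord u v (Π u v))))

-- The permutations are chosen deterministically, which exhibits the event of positive probability.
-- Rows of S × [r] are grouped in blocks of four: the first four segments of the path of an edge u → v
-- go to a block given by the rank of v among the neighbours of u, the last four to a block given by the
-- rank of u among the neighbours of v, and r ≥ 16Δ leaves rows that no block uses. Sets X, Y of 𝒜′ with
-- |X ∩ Y| = rd − 1 are at Hamming distance 2, and every set on a path shows one of its two endpoints on
-- all rows but one. A set far from both ends of its path shows its head on four rows and its tail on four
-- others, so a set at distance 2 lies on the same path. A set near a vertex z differs from z × [r] only
-- inside the block of its edge; the unused rows force two near sets to belong to the same vertex, and if
-- their edges differ, their blocks are disjoint, so one of them is z × [r]. Either way both sets lie on
-- one path, and distance 2 on a path means consecutive positions.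

module Submission where

open import Defs
open import Data.Nat using (ℕ; zero; suc; _+_; _*_; _∸_; _≤_; _<_; _⊔_; z≤n; s≤s; _!; _≤?_; _<?_)
open import Data.Nat.Properties
open import Data.Nat.ListAction using (sum)
open import Data.Bool.Properties
  using (∨-zeroʳ; ∧-comm; ∨-identityʳ; ∧-identityʳ; ∧-zeroʳ; xor-comm; xor-same) renaming (_≟_ to _≟ᵇ_)
open import Data.Bool using (Bool; true; false; if_then_else_; _∧_; _∨_; not; _xor_)
open import Data.Fin using (Fin; toℕ; fromℕ<) renaming (zero to fzero; suc to fsuc)
open import Data.Fin.Patterns using (0F; 1F; 2F; 3F)
open import Data.Fin.Properties using (toℕ-injective; toℕ<n; toℕ-fromℕ<; all?; ¬∀⟶∃¬) renaming (_≟_ to _≟ᶠ_)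
open import Data.List
  using (List; []; _∷_; map; allFin; foldr; foldl; zip; scanl; concat; concatMap; drop; take; tabulate; length; _++_)
open import Data.List.Properties
  using (map-tabulate; map-cong; length-map; map-++; take++drop≡id; take-take; foldl-++; length-drop;
         length-take; concat-map; tabulate-cong; take-all)
open import Data.List.Membership.Propositional using (_∈_; _∉_)
open import Data.List.Membership.Propositional.Properties
  using (∈-++⁺ˡ; ∈-++⁺ʳ; ∈-++⁻; ∈-concat⁺′; ∈-concat⁻′; ∈-tabulate⁺; ∈-tabulate⁻; ∈-map⁺; ∈-map⁻; ∈-allFin)
open import Data.List.Relation.Unary.Any using (Any; here; there)
open import Data.List.Relation.Unary.All using (All; []; _∷_)
open import Data.List.Relation.Unary.All.Properties using (All¬⇒¬Any)
import Data.List.Relation.Unary.All as All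
import Data.List.Relation.Unary.Any as Any
import Data.List.Relation.Unary.All.Properties as Allₚ
import Data.List.Relation.Unary.AllPairs.Properties as AllPairs
import Data.List.Relation.Unary.Unique.Propositional.Properties as Unique
open import Data.List.Relation.Unary.AllPairs using ([]; _∷_)
open import Data.List.Relation.Unary.Unique.Propositional using (Unique)
open import Data.Product using (Σ; ∃; _×_; _,_; proj₁; proj₂)
open import Data.Sum using (_⊎_; inj₁; inj₂; reduce) renaming (map to ⊎-map)
open import Data.Empty using (⊥; ⊥-elim)
open import Function using (_∘_; case_of_)
open import Function.Bundles using (Equivalence)
open import Data.Fin.Permutation
  using (Permutation′; _⟨$⟩ʳ_; _⟨$⟩ˡ_; inverseˡ; inverseʳ; permutation; _∘ₚ_) renaming (id to idₚ)
open import Relation.Binary.PropositionalEquality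
  using (_≡_; _≢_; refl; sym; trans; cong; cong₂; subst; subst₂; _≗_; module ≡-Reasoning)
open import Relation.Nullary using (¬_; Dec; yes; no; _×-dec_; _⊎-dec_)
open import Relation.Nullary.Decidable using (⌊_⌋)
open import Relation.Binary.Definitions using (tri<; tri≈; tri>)
open import Data.Nat.Solver using (module +-*-Solver)
open +-*-Solver using (solve; _:+_; _:*_; con; _:=_)
open import Algebra.Properties.CommutativeSemigroup +-commutativeSemigroup using (interchange; xy∙z≈xz∙y)

-- Sums over Fin and counting list members

𝟙 : Bool → ℕ
𝟙 b = if b then 1 else 0

∑ : ∀ n → (Fin n → ℕ) → ℕ
∑ n f = sum (map f (allFin n))

∑-suc : ∀ n (f : Fin (suc n) → ℕ) → ∑ (suc n) f ≡ f fzero + ∑ n (f ∘ fsuc)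
∑-suc n f = cong (λ L → f fzero + sum L)
  (trans (map-tabulate fsuc f) (sym (map-tabulate (λ x → x) (f ∘ fsuc))))

∑-cong : ∀ n {f g : Fin n → ℕ} → f ≗ g → ∑ n f ≡ ∑ n g
∑-cong n eq = cong sum (map-cong eq (allFin n))

∑-distrib-+ : ∀ n (f g : Fin n → ℕ) → ∑ n (λ x → f x + g x) ≡ ∑ n f + ∑ n g
∑-distrib-+ zero f g = refl
∑-distrib-+ (suc n) f g = begin
  ∑ (suc n) (λ x → f x + g x)
    ≡⟨ ∑-suc n (λ x → f x + g x) ⟩
  (f fzero + g fzero) + ∑ n (λ x → f (fsuc x) + g (fsuc x))
    ≡⟨ cong (f fzero + g fzero +_) (∑-distrib-+ n _ _) ⟩
  (f fzero + g fzero) + (∑ n (f ∘ fsuc) + ∑ n (g ∘ fsuc))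
    ≡⟨ interchange (f fzero) _ _ _ ⟩
  (f fzero + ∑ n (f ∘ fsuc)) + (g fzero + ∑ n (g ∘ fsuc))
    ≡⟨ sym (cong₂ _+_ (∑-suc n f) (∑-suc n g)) ⟩
  ∑ (suc n) f + ∑ (suc n) g ∎
  where open ≡-Reasoning

∑-mono-≤ : ∀ n {f g : Fin n → ℕ} → (∀ x → f x ≤ g x) → ∑ n f ≤ ∑ n g
∑-mono-≤ zero le = z≤n
∑-mono-≤ (suc n) {f} {g} le = subst₂ _≤_ (sym (∑-suc n f)) (sym (∑-suc n g))
  (+-mono-≤ (le fzero) (∑-mono-≤ n (le ∘ fsuc)))

∑-mono-< : ∀ n {f g : Fin n → ℕ} → (∀ x → f x ≤ g x) → ∀ a → f a < g a → ∑ n f < ∑ n g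
∑-mono-< (suc n) {f} {g} le fzero lt = subst₂ _<_ (sym (∑-suc n f)) (sym (∑-suc n g))
  (+-mono-<-≤ lt (∑-mono-≤ n (le ∘ fsuc)))
∑-mono-< (suc n) {f} {g} le (fsuc a) lt = subst₂ _<_ (sym (∑-suc n f)) (sym (∑-suc n g))
  (+-mono-≤-< (le fzero) (∑-mono-< n (le ∘ fsuc) a lt))

∑-const : ∀ n c → ∑ n (λ _ → c) ≡ n * c
∑-const zero c = refl
∑-const (suc n) c = trans (∑-suc n (λ _ → c)) (cong (c +_) (∑-const n c))

∑-zero : ∀ n {f : Fin n → ℕ} → (∀ x → f x ≡ 0) → ∑ n f ≡ 0
∑-zero n eq = trans (∑-cong n eq) (trans (∑-const n 0) (*-zeroʳ n))

∑≡0⇒ : ∀ n (f : Fin n → ℕ) → ∑ n f ≡ 0 → ∀ x → f x ≡ 0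
∑≡0⇒ (suc n) f eq fzero = m+n≡0⇒m≡0 (f fzero) (trans (sym (∑-suc n f)) eq)
∑≡0⇒ (suc n) f eq (fsuc x) = ∑≡0⇒ n (f ∘ fsuc) (m+n≡0⇒n≡0 (f fzero) (trans (sym (∑-suc n f)) eq)) x

∑-distribˡ-* : ∀ n c (f : Fin n → ℕ) → ∑ n (λ x → c * f x) ≡ c * ∑ n f
∑-distribˡ-* zero c f = sym (*-zeroʳ c)
∑-distribˡ-* (suc n) c f = begin
  ∑ (suc n) (λ x → c * f x)                ≡⟨ ∑-suc n (λ x → c * f x) ⟩
  c * f fzero + ∑ n (λ x → c * f (fsuc x)) ≡⟨ cong (c * f fzero +_) (∑-distribˡ-* n c (f ∘ fsuc)) ⟩
  c * f fzero + c * ∑ n (f ∘ fsuc)         ≡⟨ sym (*-distribˡ-+ c (f fzero) _) ⟩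
  c * (f fzero + ∑ n (f ∘ fsuc))           ≡⟨ cong (c *_) (sym (∑-suc n f)) ⟩
  c * ∑ (suc n) f                          ∎
  where open ≡-Reasoning

∑-𝟙-≟ : ∀ n (a : Fin n) → ∑ n (λ x → 𝟙 ⌊ x ≟ᶠ a ⌋) ≡ 1
∑-𝟙-≟ (suc n) fzero = trans (∑-suc n (λ x → 𝟙 ⌊ x ≟ᶠ fzero ⌋)) (cong suc (∑-zero n (λ _ → refl)))
∑-𝟙-≟ (suc n) (fsuc a) =
  trans (∑-suc n (λ x → 𝟙 ⌊ x ≟ᶠ fsuc a ⌋)) (trans (∑-cong n suc≟suc) (∑-𝟙-≟ n a))
  where
  suc≟suc : ∀ x → 𝟙 ⌊ fsuc x ≟ᶠ fsuc a ⌋ ≡ 𝟙 ⌊ x ≟ᶠ a ⌋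
  suc≟suc x with x ≟ᶠ a
  ... | yes refl = refl
  ... | no _ = refl

module Counting {T : Set} (_==_ : T → T → Bool)
  (==⇒≡ : ∀ a b → (a == b) ≡ true → a ≡ b) (==-refl : ∀ a → (a == a) ≡ true)
  (S : (T → ℕ) → ℕ)
  (S-cong : ∀ {f g} → f ≗ g → S f ≡ S g)
  (S-distrib-+ : ∀ f g → S (λ t → f t + g t) ≡ S f + S g)
  (S-mono-≤ : ∀ {f g} → (∀ t → f t ≤ g t) → S f ≤ S g)
  (S-zero : S (λ _ → 0) ≡ 0)
  (S-𝟙-== : ∀ a → S (λ t → 𝟙 (t == a)) ≡ 1) where

  mem : T → List T → Bool
  mem t [] = false
  mem t (a ∷ L) = (t == a) ∨ mem t L

  mem⇒∈ : ∀ {t} L → mem t L ≡ true → t ∈ L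
  mem⇒∈ {t} (a ∷ L) eq with t == a in e
  ... | true = here (==⇒≡ t a e)
  ... | false = there (mem⇒∈ L eq)

  ∈⇒mem : ∀ {t L} → t ∈ L → mem t L ≡ true
  ∈⇒mem {t} (here refl) rewrite ==-refl t = refl
  ∈⇒mem {t} {a ∷ L} (there p) rewrite ∈⇒mem p = ∨-zeroʳ (t == a)

  ∉⇒mem≡false : ∀ {t} L → t ∉ L → mem t L ≡ false
  ∉⇒mem≡false {t} L t∉L with mem t L in e
  ... | true = ⊥-elim (t∉L (mem⇒∈ L e))
  ... | false = refl

  mem≡false⇒∉ : ∀ {t L} → mem t L ≡ false → t ∉ L
  mem≡false⇒∉ e t∈L with trans (sym e) (∈⇒mem t∈L)
  ... | ()

  S-mem : ∀ L → Unique L → S (λ t → 𝟙 (mem t L)) ≡ length L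
  S-mem [] u = S-zero
  S-mem (a ∷ L) (a∉L ∷ u) =
    trans (S-cong split) (trans (S-distrib-+ _ _) (cong₂ _+_ (S-𝟙-== a) (S-mem L u)))
    where
    split : ∀ t → 𝟙 (mem t (a ∷ L)) ≡ 𝟙 (t == a) + 𝟙 (mem t L)
    split t with t == a in e
    ... | true rewrite ==⇒≡ t a e | ∉⇒mem≡false L (All¬⇒¬Any a∉L) = refl
    ... | false = refl

  S-≥3 : ∀ (g : T → ℕ) a b c → a ≢ b → a ≢ c → b ≢ c →
    1 ≤ g a → 1 ≤ g b → 1 ≤ g c → 3 ≤ S g
  S-≥3 g a b c a≢b a≢c b≢c ga gb gc = subst (_≤ S g) (S-mem (a ∷ b ∷ c ∷ []) abc-unique) (S-mono-≤ bound)
    where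
    abc-unique : Unique (a ∷ b ∷ c ∷ [])
    abc-unique = (a≢b ∷ a≢c ∷ []) ∷ (b≢c ∷ []) ∷ [] ∷ []
    bound : ∀ t → 𝟙 (mem t (a ∷ b ∷ c ∷ [])) ≤ g t
    bound t with t == a in e₁ | t == b in e₂ | t == c in e₃
    ... | true | _ | _ rewrite ==⇒≡ t a e₁ = ga
    ... | false | true | _ rewrite ==⇒≡ t b e₂ = gb
    ... | false | false | true rewrite ==⇒≡ t c e₃ = gc
    ... | false | false | false = z≤n

≟-true⇒≡ : ∀ {n} (a b : Fin n) → ⌊ a ≟ᶠ b ⌋ ≡ true → a ≡ b
≟-true⇒≡ a b e with a ≟ᶠ b
... | yes a≡b = a≡b

≟-refl : ∀ {n} (a : Fin n) → ⌊ a ≟ᶠ a ⌋ ≡ true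
≟-refl a with a ≟ᶠ a
... | yes _ = refl
... | no a≢a = ⊥-elim (a≢a refl)

≢⇒≟-false : ∀ {n} {a b : Fin n} → a ≢ b → ⌊ a ≟ᶠ b ⌋ ≡ false
≢⇒≟-false {a = a} {b} a≢b with a ≟ᶠ b
... | yes a≡b = ⊥-elim (a≢b a≡b)
... | no _ = refl

module CountFin (n : ℕ) = Counting (λ (a b : Fin n) → ⌊ a ≟ᶠ b ⌋) ≟-true⇒≡ ≟-refl
  (∑ n) (∑-cong n) (∑-distrib-+ n) (∑-mono-≤ n) (∑-zero n (λ _ → refl)) (∑-𝟙-≟ n)

Cell : ℕ → ℕ → Set
Cell s r = Fin s × Fin r

_==ᶜ_ : ∀ {s r} → Cell s r → Cell s r → Bool
(y , l) ==ᶜ (b , ρ) = ⌊ y ≟ᶠ b ⌋ ∧ ⌊ l ≟ᶠ ρ ⌋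

==ᶜ⇒≡ : ∀ {s r} (c c′ : Cell s r) → (c ==ᶜ c′) ≡ true → c ≡ c′
==ᶜ⇒≡ (y , l) (b , ρ) e with y ≟ᶠ b | l ≟ᶠ ρ
... | yes refl | yes refl = refl

==ᶜ-refl : ∀ {s r} (c : Cell s r) → (c ==ᶜ c) ≡ true
==ᶜ-refl (y , l) rewrite ≟-refl y | ≟-refl l = refl

∑ᶜ : ∀ s r → (Cell s r → ℕ) → ℕ
∑ᶜ s r g = ∑ s (λ x → ∑ r (λ i → g (x , i)))

module _ (s r : ℕ) where

  ∑ᶜ-cong : ∀ {f g : Cell s r → ℕ} → f ≗ g → ∑ᶜ s r f ≡ ∑ᶜ s r g
  ∑ᶜ-cong eq = ∑-cong s (λ x → ∑-cong r (λ i → eq (x , i)))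

  ∑ᶜ-distrib-+ : ∀ (f g : Cell s r → ℕ) → ∑ᶜ s r (λ c → f c + g c) ≡ ∑ᶜ s r f + ∑ᶜ s r g
  ∑ᶜ-distrib-+ f g = trans (∑-cong s (λ x → ∑-distrib-+ r _ _)) (∑-distrib-+ s _ _)

  ∑ᶜ-mono-≤ : ∀ {f g : Cell s r → ℕ} → (∀ c → f c ≤ g c) → ∑ᶜ s r f ≤ ∑ᶜ s r g
  ∑ᶜ-mono-≤ le = ∑-mono-≤ s (λ x → ∑-mono-≤ r (λ i → le (x , i)))

  ∑ᶜ-zero : ∑ᶜ s r (λ _ → 0) ≡ 0
  ∑ᶜ-zero = ∑-zero s (λ x → ∑-zero r (λ _ → refl))

  ∑ᶜ-𝟙-==ᶜ : ∀ c → ∑ᶜ s r (λ c′ → 𝟙 (c′ ==ᶜ c)) ≡ 1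
  ∑ᶜ-𝟙-==ᶜ (b , ρ) = trans (∑-cong s row) (∑-𝟙-≟ s b)
    where
    row : ∀ x → ∑ r (λ i → 𝟙 (⌊ x ≟ᶠ b ⌋ ∧ ⌊ i ≟ᶠ ρ ⌋)) ≡ 𝟙 ⌊ x ≟ᶠ b ⌋
    row x with ⌊ x ≟ᶠ b ⌋
    ... | true = ∑-𝟙-≟ r ρ
    ... | false = ∑-zero r (λ _ → refl)

  ∑ᶜ≡0⇒ : ∀ (f : Cell s r → ℕ) → ∑ᶜ s r f ≡ 0 → ∀ c → f c ≡ 0
  ∑ᶜ≡0⇒ f eq (x , i) = ∑≡0⇒ r _ (∑≡0⇒ s _ eq x) i

module CountCell (s r : ℕ) = Counting _==ᶜ_ ==ᶜ⇒≡ ==ᶜ-refl (∑ᶜ s r)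
  (∑ᶜ-cong s r) (∑ᶜ-distrib-+ s r) (∑ᶜ-mono-≤ s r) (∑ᶜ-zero s r) (∑ᶜ-𝟙-==ᶜ s r)

-- Hamming distance

≐-sym : ∀ {s r} {X Y : Sub₂ s r} → X ≐ Y → Y ≐ X
≐-sym X≐Y x i = sym (X≐Y x i)

≐-trans : ∀ {s r} {X Y Z : Sub₂ s r} → X ≐ Y → Y ≐ Z → X ≐ Z
≐-trans X≐Y Y≐Z x i = trans (X≐Y x i) (Y≐Z x i)

at : ∀ {s r} → Sub₂ s r → Cell s r → Bool
at X (x , i) = X x i

dist : ∀ {s r} → Sub₂ s r → Sub₂ s r → ℕ
dist {s} {r} X Y = ∑ᶜ s r (λ c → 𝟙 (at X c xor at Y c))

module _ {s r : ℕ} where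

  card₂-cong : ∀ {X Y : Sub₂ s r} → X ≐ Y → card₂ X ≡ card₂ Y
  card₂-cong eq = ∑ᶜ-cong s r (λ { (x , i) → cong 𝟙 (eq x i) })

  card₂-lift : ∀ (A : Sub s) → card₂ (lift r A) ≡ r * card A
  card₂-lift A = trans (∑-cong s (λ x → ∑-const r (𝟙 (A x)))) (∑-distribˡ-* s r (λ x → 𝟙 (A x)))

  card₂-+-card₂ : ∀ (X Y : Sub₂ s r) →
    card₂ X + card₂ Y ≡ (card₂ (X ∩₂ Y) + card₂ (X ∩₂ Y)) + dist X Y
  card₂-+-card₂ X Y = trans (sym (∑ᶜ-distrib-+ s r _ _)) (trans (∑ᶜ-cong s r cellwise)
    (trans (∑ᶜ-distrib-+ s r _ _) (cong (_+ dist X Y) (∑ᶜ-distrib-+ s r _ _))))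
    where
    cellwise : ∀ c → 𝟙 (at X c) + 𝟙 (at Y c) ≡
      (𝟙 (at X c ∧ at Y c) + 𝟙 (at X c ∧ at Y c)) + 𝟙 (at X c xor at Y c)
    cellwise c with at X c | at Y c
    ... | true | true = refl
    ... | true | false = refl
    ... | false | true = refl
    ... | false | false = refl

  dist≡2 : ∀ {X Y : Sub₂ s r} {n} → card₂ X ≡ n → card₂ Y ≡ n → card₂ (X ∩₂ Y) + 1 ≡ n → dist X Y ≡ 2
  dist≡2 {X} {Y} {n} ∣X∣ ∣Y∣ ∣X∩Y∣ = +-cancelˡ-≡ (c + c) (dist X Y) 2 (begin
    (c + c) + dist X Y     ≡⟨ sym (card₂-+-card₂ X Y) ⟩
    card₂ X + card₂ Y      ≡⟨ cong₂ _+_ (trans ∣X∣ (sym ∣X∩Y∣)) (trans ∣Y∣ (sym ∣X∩Y∣)) ⟩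
    (c + 1) + (c + 1)      ≡⟨ solve 1 (λ c → (c :+ con 1) :+ (c :+ con 1) := (c :+ c) :+ con 2) refl c ⟩
    (c + c) + 2            ∎)
    where
    c = card₂ (X ∩₂ Y)
    open ≡-Reasoning

  dist-sym : ∀ (X Y : Sub₂ s r) → dist X Y ≡ dist Y X
  dist-sym X Y = ∑ᶜ-cong s r (λ c → cong 𝟙 (xor-comm (at X c) (at Y c)))

  dist-cong : ∀ {X X′ Y Y′ : Sub₂ s r} → X ≐ X′ → Y ≐ Y′ → dist X Y ≡ dist X′ Y′
  dist-cong eqX eqY = ∑ᶜ-cong s r (λ { (x , i) → cong₂ (λ a b → 𝟙 (a xor b)) (eqX x i) (eqY x i) })

  dist-self : ∀ (X : Sub₂ s r) → dist X X ≡ 0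
  dist-self X = trans (∑ᶜ-cong s r (λ c → cong 𝟙 (xor-same (at X c)))) (∑ᶜ-zero s r)

  dist≡0⇒≐ : ∀ (X Y : Sub₂ s r) → dist X Y ≡ 0 → X ≐ Y
  dist≡0⇒≐ X Y eq x i = xor≡false (X x i) (Y x i) (∑ᶜ≡0⇒ s r _ eq (x , i))
    where
    xor≡false : ∀ a b → 𝟙 (a xor b) ≡ 0 → a ≡ b
    xor≡false true true _ = refl
    xor≡false false false _ = refl

  dist-via : ∀ (X Y Z : Sub₂ s r) → (∀ x i → X x i ≡ Z x i ⊎ Y x i ≡ Z x i) →
    dist X Y ≡ dist X Z + dist Y Z
  dist-via X Y Z agree = trans (∑ᶜ-cong s r cellwise) (∑ᶜ-distrib-+ s r _ _)
    where
    cellwise : ∀ c → 𝟙 (at X c xor at Y c) ≡ 𝟙 (at X c xor at Z c) + 𝟙 (at Y c xor at Z c)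
    cellwise (x , i) with agree x i
    ... | inj₁ e rewrite e | xor-same (Z x i) = cong 𝟙 (xor-comm (Z x i) (Y x i))
    ... | inj₂ e rewrite e | xor-same (Z x i) = sym (+-identityʳ _)

  RowDiffer : Sub₂ s r → Sub₂ s r → Fin r → Set
  RowDiffer X Y i = ∃ λ x → X x i ≢ Y x i

  dist-≥3 : ∀ (X Y : Sub₂ s r) (i j k : Fin r) → i ≢ j → i ≢ k → j ≢ k →
    RowDiffer X Y i → RowDiffer X Y j → RowDiffer X Y k → 3 ≤ dist X Y
  dist-≥3 X Y i j k i≢j i≢k j≢k (x , dx) (y , dy) (z , dz) =
    CountCell.S-≥3 s r _ (x , i) (y , j) (z , k) (rows i≢j) (rows i≢k) (rows j≢k) (differ dx) (differ dy) (differ dz)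
    where
    rows : ∀ {a b : Fin s} {p q : Fin r} → p ≢ q → (a , p) ≢ (b , q)
    rows p≢q refl = p≢q refl
    differ : ∀ {a b} → a ≢ b → 1 ≤ 𝟙 (a xor b)
    differ {true} {true} a≢b = ⊥-elim (a≢b refl)
    differ {true} {false} _ = s≤s z≤n
    differ {false} {true} _ = s≤s z≤n
    differ {false} {false} a≢b = ⊥-elim (a≢b refl)

-- Applying elementary steps

Unique-++⁻ : ∀ {A : Set} (xs ys : List A) → Unique (xs ++ ys) →
  Unique xs × Unique ys × (∀ {v} → v ∈ xs → v ∉ ys)
Unique-++⁻ [] ys u = [] , u , λ ()
Unique-++⁻ (x ∷ xs) ys (x∉ ∷ u) with Unique-++⁻ xs ys u | Allₚ.++⁻ xs x∉
... | uxs , uys , disjoint | x∉xs , x∉ys = x∉xs ∷ uxs , uys , λ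
  { (here refl) → All¬⇒¬Any x∉ys
  ; (there v∈xs) → disjoint v∈xs }

Step : ℕ → ℕ → Set
Step s r = Fin r × Fin s × Fin s

module _ {s r : ℕ} where
  open CountCell s r using (mem; mem⇒∈; ∈⇒mem; ∉⇒mem≡false; mem≡false⇒∉; S-mem)

  removed added : Step s r → Cell s r
  removed (ρ , a , b) = (a , ρ)
  added (ρ , a , b) = (b , ρ)

  rems adds : List (Step s r) → List (Cell s r)
  rems = map removed
  adds = map added

  applySteps : Sub₂ s r → List (Step s r) → Sub₂ s r
  applySteps = foldl stepSet

  applySteps-cell : ∀ (W : Sub₂ s r) L → (∀ {c} → c ∈ adds L → c ∉ rems L) → ∀ y l →
    applySteps W L y l ≡ (W y l ∧ not (mem (y , l) (rems L))) ∨ mem (y , l) (adds L)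
  applySteps-cell W [] _ y l = sym (trans (∨-identityʳ _) (∧-identityʳ (W y l)))
  applySteps-cell W (st@(ρ , a , b) ∷ L) disjoint y l =
    trans (applySteps-cell (stepSet W st) L (λ c∈ c∈′ → disjoint (there c∈) (there c∈′)) y l)
          (one-more-step {(y , l) ==ᶜ (b , ρ)} {(y , l) ==ᶜ (a , ρ)} (W y l)
            (∉⇒mem≡false (rems (st ∷ L)) ∘ disjoint ∘ mem⇒∈ {y , l} (adds (st ∷ L))))
    where
    one-more-step : ∀ {B A R Ad} w → (B ∨ Ad ≡ true → A ∨ R ≡ false) →
      ((if B then true else (if A then false else w)) ∧ not R) ∨ Ad ≡ (w ∧ not (A ∨ R)) ∨ (B ∨ Ad)
    one-more-step {true} {true} w h with h refl
    ... | ()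
    one-more-step {true} {false} {true} w h with h refl
    ... | ()
    one-more-step {true} {false} {false} w h = sym (∨-zeroʳ _)
    one-more-step {false} {true} true h = refl
    one-more-step {false} {true} false h = refl
    one-more-step {false} {false} w h = refl

  applySteps-untouched : ∀ (W : Sub₂ s r) L y l → All (λ st → proj₁ st ≢ l) L → applySteps W L y l ≡ W y l
  applySteps-untouched W [] y l _ = refl
  applySteps-untouched W ((ρ , a , b) ∷ L) y l (ρ≢l ∷ L-misses-l) =
    trans (applySteps-untouched (stepSet W (ρ , a , b)) L y l L-misses-l) step-misses-l
    where
    step-misses-l : stepSet W (ρ , a , b) y l ≡ W y l
    step-misses-l rewrite ≢⇒≟-false (ρ≢l ∘ sym) | ∧-zeroʳ ⌊ y ≟ᶠ b ⌋ | ∧-zeroʳ ⌊ y ≟ᶠ a ⌋ = refl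

  record Admissible (W : Sub₂ s r) (L : List (Step s r)) : Set where
    field
      rems-unique : Unique (rems L)
      adds-unique : Unique (adds L)
      adds-disjoint : ∀ {c} → c ∈ adds L → c ∉ rems L
      rems-⊆ : ∀ {c} → c ∈ rems L → at W c ≡ true
      adds-∩-∅ : ∀ {c} → c ∈ adds L → at W c ≡ false
  open Admissible

  card₂-applySteps : ∀ {W} L → Admissible W L → card₂ (applySteps W L) ≡ card₂ W
  card₂-applySteps {W} L adm = +-cancelʳ-≡ _ _ _ (begin
    card₂ (applySteps W L) + length L
      ≡⟨ cong (card₂ (applySteps W L) +_) (sym (trans (S-mem _ (rems-unique adm)) (length-map removed L))) ⟩
    card₂ (applySteps W L) + ∑ᶜ s r (λ c → 𝟙 (mem c (rems L)))
      ≡⟨ sym (∑ᶜ-distrib-+ s r _ _) ⟩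
    ∑ᶜ s r (λ c → 𝟙 (at (applySteps W L) c) + 𝟙 (mem c (rems L)))
      ≡⟨ ∑ᶜ-cong s r cellwise ⟩
    ∑ᶜ s r (λ c → 𝟙 (at W c) + 𝟙 (mem c (adds L)))
      ≡⟨ ∑ᶜ-distrib-+ s r _ _ ⟩
    card₂ W + ∑ᶜ s r (λ c → 𝟙 (mem c (adds L)))
      ≡⟨ cong (card₂ W +_) (trans (S-mem _ (adds-unique adm)) (length-map added L)) ⟩
    card₂ W + length L ∎)
    where
    open ≡-Reasoning
    cellwise : ∀ c → 𝟙 (at (applySteps W L) c) + 𝟙 (mem c (rems L)) ≡ 𝟙 (at W c) + 𝟙 (mem c (adds L))
    cellwise (y , l) rewrite applySteps-cell W L (adds-disjoint adm) y l
      with mem (y , l) (rems L) in eR | mem (y , l) (adds L) in eA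
    ... | true | true = ⊥-elim (adds-disjoint adm (mem⇒∈ _ eA) (mem⇒∈ _ eR))
    ... | true | false rewrite rems-⊆ adm (mem⇒∈ _ eR) = refl
    ... | false | true rewrite adds-∩-∅ adm (mem⇒∈ _ eA) = refl
    ... | false | false rewrite ∧-identityʳ (W y l) | ∨-identityʳ (W y l) = refl

  dist-applySteps : ∀ {W} L → Admissible W L → dist W (applySteps W L) ≡ length L + length L
  dist-applySteps {W} L adm = trans (∑ᶜ-cong s r cellwise) (trans (∑ᶜ-distrib-+ s r _ _)
    (cong₂ _+_ (trans (S-mem _ (rems-unique adm)) (length-map removed L))
               (trans (S-mem _ (adds-unique adm)) (length-map added L))))
    where
    cellwise : ∀ c → 𝟙 (at W c xor at (applySteps W L) c) ≡ 𝟙 (mem c (rems L)) + 𝟙 (mem c (adds L))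
    cellwise (y , l) rewrite applySteps-cell W L (adds-disjoint adm) y l
      with mem (y , l) (rems L) in eR | mem (y , l) (adds L) in eA
    ... | true | true = ⊥-elim (adds-disjoint adm (mem⇒∈ _ eA) (mem⇒∈ _ eR))
    ... | true | false rewrite rems-⊆ adm (mem⇒∈ _ eR) = refl
    ... | false | true rewrite adds-∩-∅ adm (mem⇒∈ _ eA) = refl
    ... | false | false rewrite ∧-identityʳ (W y l) | ∨-identityʳ (W y l) | xor-same (W y l) = refl

  Admissible-++ : ∀ {W} xs ys → Admissible W (xs ++ ys) → Admissible W xs × Admissible (applySteps W xs) ys
  Admissible-++ {W} xs ys adm = prefix , suffix
    where
    split : ∀ (f : Step s r → Cell s r) → Unique (map f (xs ++ ys)) →
      Unique (map f xs) × Unique (map f ys) × (∀ {c} → c ∈ map f xs → c ∉ map f ys)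
    split f u = Unique-++⁻ (map f xs) _ (subst Unique (map-++ f xs ys) u)
    inˡ : ∀ (f : Step s r → Cell s r) {c} → c ∈ map f xs → c ∈ map f (xs ++ ys)
    inˡ f = subst (_ ∈_) (sym (map-++ f xs ys)) ∘ ∈-++⁺ˡ
    inʳ : ∀ (f : Step s r → Cell s r) {c} → c ∈ map f ys → c ∈ map f (xs ++ ys)
    inʳ f = subst (_ ∈_) (sym (map-++ f xs ys)) ∘ ∈-++⁺ʳ (map f xs)
    prefix : Admissible W xs
    prefix = record
      { rems-unique = proj₁ (split removed (rems-unique adm))
      ; adds-unique = proj₁ (split added (adds-unique adm))
      ; adds-disjoint = λ c∈ c∈′ → adds-disjoint adm (inˡ added c∈) (inˡ removed c∈′)
      ; rems-⊆ = rems-⊆ adm ∘ inˡ removed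
      ; adds-∩-∅ = adds-∩-∅ adm ∘ inˡ added }
    after-prefix : ∀ y l → applySteps W xs y l ≡ (W y l ∧ not (mem (y , l) (rems xs))) ∨ mem (y , l) (adds xs)
    after-prefix = applySteps-cell W xs (adds-disjoint prefix)
    suffix : Admissible (applySteps W xs) ys
    suffix = record
      { rems-unique = proj₁ (proj₂ (split removed (rems-unique adm)))
      ; adds-unique = proj₁ (proj₂ (split added (adds-unique adm)))
      ; adds-disjoint = λ c∈ c∈′ → adds-disjoint adm (inʳ added c∈) (inʳ removed c∈′)
      ; rems-⊆ = λ { {y , l} c∈ → begin
          applySteps W xs y l
            ≡⟨ after-prefix y l ⟩
          (W y l ∧ not (mem (y , l) (rems xs))) ∨ mem (y , l) (adds xs)
            ≡⟨ cong₂ (λ w m → (w ∧ not m) ∨ mem (y , l) (adds xs)) (rems-⊆ adm (inʳ removed c∈))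
                 (∉⇒mem≡false (rems xs) (λ c∈′ → proj₂ (proj₂ (split removed (rems-unique adm))) c∈′ c∈)) ⟩
          true ∨ mem (y , l) (adds xs)
            ≡⟨⟩
          true ∎ }
      ; adds-∩-∅ = λ { {y , l} c∈ → begin
          applySteps W xs y l
            ≡⟨ after-prefix y l ⟩
          (W y l ∧ not (mem (y , l) (rems xs))) ∨ mem (y , l) (adds xs)
            ≡⟨ cong₂ (λ w m → (w ∧ not (mem (y , l) (rems xs))) ∨ m) (adds-∩-∅ adm (inʳ added c∈))
                 (∉⇒mem≡false (adds xs) (λ c∈′ → proj₂ (proj₂ (split added (adds-unique adm))) c∈′ c∈)) ⟩
          false ∎ } }
      where open ≡-Reasoning

  Admissible-take : ∀ {W} n L → Admissible W L → Admissible W (take n L)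
  Admissible-take n L adm =
    proj₁ (Admissible-++ (take n L) (drop n L) (subst (Admissible _) (sym (take++drop≡id n L)) adm))

  walk : Sub₂ s r → List (Step s r) → ℕ → Sub₂ s r
  walk W S p = applySteps W (take p S)

  module _ {W : Sub₂ s r} {S : List (Step s r)} {p q : ℕ} (p≤q : p ≤ q) where

    take-via-prefix : take q S ≡ take p S ++ drop p (take q S)
    take-via-prefix = trans (sym (take++drop≡id p (take q S)))
      (cong (_++ drop p (take q S)) (trans (take-take p q S) (cong (λ n → take n S) (m≤n⇒m⊓n≡m p≤q))))

    walk-via-prefix : walk W S q ≡ applySteps (walk W S p) (drop p (take q S))
    walk-via-prefix = trans (cong (applySteps W) take-via-prefix) (foldl-++ stepSet W (take p S) _)

    Admissible-between : Admissible W S → Admissible (walk W S p) (drop p (take q S))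
    Admissible-between adm = proj₂ (Admissible-++ (take p S) _
      (subst (Admissible W) take-via-prefix (Admissible-take q S adm)))

    dist-walk : q ≤ length S → Admissible W S → dist (walk W S p) (walk W S q) ≡ (q ∸ p) + (q ∸ p)
    dist-walk q≤∣S∣ adm = begin
      dist (walk W S p) (walk W S q)
        ≡⟨ cong (dist (walk W S p)) walk-via-prefix ⟩
      dist (walk W S p) (applySteps (walk W S p) (drop p (take q S)))
        ≡⟨ dist-applySteps _ (Admissible-between adm) ⟩
      length (drop p (take q S)) + length (drop p (take q S))
        ≡⟨ cong (λ n → n + n) ∣between∣ ⟩
      (q ∸ p) + (q ∸ p) ∎
      where
      open ≡-Reasoning
      ∣between∣ : length (drop p (take q S)) ≡ q ∸ p
      ∣between∣ = trans (length-drop p (take q S)) (cong (_∸ p) (trans (length-take q S) (m≤n⇒m⊓n≡m q≤∣S∣)))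

  card₂-walk : ∀ {W} S p → Admissible W S → card₂ (walk W S p) ≡ card₂ W
  card₂-walk S p adm = card₂-applySteps (take p S) (Admissible-take p S adm)

Any-scanl⁻ : ∀ {A B : Set} {Q : A → Set} (f : A → B → A) z (L : List B) →
  Any Q (scanl f z L) → ∃ λ p → p ≤ length L × Q (foldl f z (take p L))
Any-scanl⁻ f z [] (here q) = 0 , z≤n , q
Any-scanl⁻ f z (x ∷ L) (here q) = 0 , z≤n , q
Any-scanl⁻ f z (x ∷ L) (there q) with Any-scanl⁻ f (f z x) L q
... | p , p≤ , qp = suc p , s≤s p≤ , qp

Any-zip-scanl⁺ : ∀ {A B : Set} {R : A × A → Set} (f : A → B → A) z (L : List B) p → p < length L →
  R (foldl f z (take p L) , foldl f z (take (suc p) L)) →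
  Any R (zip (scanl f z L) (drop 1 (scanl f z L)))
Any-zip-scanl⁺ f z (x ∷ []) zero _ q = here q
Any-zip-scanl⁺ f z (x ∷ y ∷ L) zero _ q = here q
Any-zip-scanl⁺ f z (x ∷ []) (suc p) (s≤s ()) q
Any-zip-scanl⁺ f z (x ∷ y ∷ L) (suc p) (s≤s p<) q = there (Any-zip-scanl⁺ f (f z x) (y ∷ L) p p< q)

module _ {A : Set} {x : A} where

  ∈-take⁻ : ∀ p xs → x ∈ take p xs → 0 < p × x ∈ xs
  ∈-take⁻ (suc p) (y ∷ xs) (here e) = s≤s z≤n , here e
  ∈-take⁻ (suc p) (y ∷ xs) (there x∈) = s≤s z≤n , there (proj₂ (∈-take⁻ p xs x∈))

  ∈-drop⁻ : ∀ p xs → x ∈ drop p xs → p < length xs × x ∈ xs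
  ∈-drop⁻ zero (y ∷ xs) x∈ = s≤s z≤n , x∈
  ∈-drop⁻ (suc p) (y ∷ xs) x∈ with ∈-drop⁻ p xs x∈
  ... | p< , x∈xs = s≤s p< , there x∈xs

  ∈-take-++⁻ : ∀ p xs ys → x ∈ take p (xs ++ ys) → x ∈ take p xs ⊎ x ∈ take (p ∸ length xs) ys
  ∈-take-++⁻ p [] ys x∈ = inj₂ x∈
  ∈-take-++⁻ (suc p) (y ∷ xs) ys (here e) = inj₁ (here e)
  ∈-take-++⁻ (suc p) (y ∷ xs) ys (there x∈) with ∈-take-++⁻ p xs ys x∈
  ... | inj₁ x∈′ = inj₁ (there x∈′)
  ... | inj₂ x∈′ = inj₂ x∈′

  ∈-drop-++⁻ : ∀ p xs ys → x ∈ drop p (xs ++ ys) → x ∈ drop p xs ⊎ x ∈ drop (p ∸ length xs) ys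
  ∈-drop-++⁻ p [] ys x∈ = inj₂ x∈
  ∈-drop-++⁻ zero (y ∷ xs) ys x∈ = ∈-++⁻ (y ∷ xs) x∈
  ∈-drop-++⁻ (suc p) (y ∷ xs) ys x∈ = ∈-drop-++⁻ p xs ys x∈

<∸⇒+< : ∀ m n o → m < n ∸ o → o + m < n
<∸⇒+< m n o m<n∸o = subst (o + m <_) (m+[n∸m]≡n o≤n) (+-monoʳ-< o m<n∸o)
  where
  o≤n : o ≤ n
  o≤n = <⇒≤ (m∸n≢0⇒n<m (λ n∸o≡0 → n≮0 (subst (m <_) n∸o≡0 m<n∸o)))

∸<⇒<+ : ∀ m n o → n ∸ o < m → n < o + m
∸<⇒<+ m n o n∸o<m = ≤-<-trans (m≤n+m∸n n o) (+-monoʳ-< o n∸o<m)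

module _ {X : Set} (k : ℕ) where

  ∈-take-blocks⁻ : ∀ n (block : Fin n → List X) → (∀ j → length (block j) ≡ k) →
    ∀ p {x} → x ∈ take p (concat (tabulate block)) → ∃ λ j → x ∈ block j × toℕ j * k < p
  ∈-take-blocks⁻ zero block _ zero ()
  ∈-take-blocks⁻ zero block _ (suc p) ()
  ∈-take-blocks⁻ (suc n) block ∣block∣ p x∈ with ∈-take-++⁻ p (block fzero) _ x∈
  ... | inj₁ x∈₀ = fzero , proj₂ (∈-take⁻ p _ x∈₀) , proj₁ (∈-take⁻ p _ x∈₀)
  ... | inj₂ x∈ʳ with ∈-take-blocks⁻ n (block ∘ fsuc) (∣block∣ ∘ fsuc) (p ∸ length (block fzero)) x∈ʳ
  ... | j , x∈j , j*k< = fsuc j , x∈j , <∸⇒+< _ p k (subst (λ m → toℕ j * k < p ∸ m) (∣block∣ fzero) j*k<)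

  ∈-drop-blocks⁻ : ∀ n (block : Fin n → List X) → (∀ j → length (block j) ≡ k) →
    ∀ p {x} → x ∈ drop p (concat (tabulate block)) → ∃ λ j → x ∈ block j × p < suc (toℕ j) * k
  ∈-drop-blocks⁻ zero block _ zero ()
  ∈-drop-blocks⁻ zero block _ (suc p) ()
  ∈-drop-blocks⁻ (suc n) block ∣block∣ p x∈ with ∈-drop-++⁻ p (block fzero) _ x∈
  ... | inj₁ x∈₀ = fzero , proj₂ (∈-drop⁻ p _ x∈₀) ,
                   subst (p <_) (trans (∣block∣ fzero) (sym (+-identityʳ k))) (proj₁ (∈-drop⁻ p _ x∈₀))
  ... | inj₂ x∈ʳ with ∈-drop-blocks⁻ n (block ∘ fsuc) (∣block∣ ∘ fsuc) (p ∸ length (block fzero)) x∈ʳ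
  ... | j , x∈j , <j*k =
    fsuc j , x∈j , ∸<⇒<+ _ p k (subst (λ m → p ∸ m < suc (toℕ j) * k) (∣block∣ fzero) <j*k)

-- The interpolation path of one edge

length-enumeration : ∀ {s} {L : List (Fin s)} {A B : Sub s} →
  Enumerates L A B → length L ≡ count (λ x → A x ∧ not (B x))
length-enumeration {s} {L} {A} {B} (L-unique , L⇔A∖B) = trans (sym (S-mem L L-unique)) (∑-cong s indicator)
  where
  open CountFin s using (mem; mem⇒∈; mem≡false⇒∉; S-mem)
  indicator : ∀ x → 𝟙 (mem x L) ≡ 𝟙 (A x ∧ not (B x))
  indicator x with mem x L in e
  ... | true with Equivalence.to (L⇔A∖B x) (mem⇒∈ L e)
  ...   | Ax , Bx rewrite Ax | Bx = refl
  indicator x | false with A x in eA | B x in eB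
  ... | true | false = ⊥-elim (mem≡false⇒∉ e (Equivalence.from (L⇔A∖B x) (eA , eB)))
  ... | true | true = refl
  ... | false | _ = refl

count-∖-comm : ∀ {s} (A B : Sub s) → card A ≡ card B →
  count (λ x → A x ∧ not (B x)) ≡ count (λ x → B x ∧ not (A x))
count-∖-comm {s} A B ∣A∣≡∣B∣ = +-cancelˡ-≡ (count (λ x → A x ∧ B x)) _ _ (begin
  count (λ x → A x ∧ B x) + count (λ x → A x ∧ not (B x)) ≡⟨ sym (split A B) ⟩
  card A                                                  ≡⟨ ∣A∣≡∣B∣ ⟩
  card B                                                  ≡⟨ split B A ⟩
  count (λ x → B x ∧ A x) + count (λ x → B x ∧ not (A x))
    ≡⟨ cong (_+ count (λ x → B x ∧ not (A x))) (∑-cong s (λ x → cong 𝟙 (∧-comm (B x) (A x)))) ⟩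
  count (λ x → A x ∧ B x) + count (λ x → B x ∧ not (A x)) ∎)
  where
  open ≡-Reasoning
  split : ∀ (A B : Sub s) → card A ≡ count (λ x → A x ∧ B x) + count (λ x → A x ∧ not (B x))
  split A B = trans (∑-cong s cellwise) (∑-distrib-+ s _ _)
    where
    cellwise : ∀ x → 𝟙 (A x) ≡ 𝟙 (A x ∧ B x) + 𝟙 (A x ∧ not (B x))
    cellwise x with A x | B x
    ... | true | true = refl
    ... | true | false = refl
    ... | false | _ = refl

module _ {s r : ℕ} (ρ : Fin r) where

  rems-zip : ∀ (as bs : List (Fin s)) → length as ≡ length bs →
    rems (map (λ ab → (ρ , ab)) (zip as bs)) ≡ map (λ a → (a , ρ)) as
  rems-zip [] [] _ = refl
  rems-zip (a ∷ as) (b ∷ bs) e = cong ((a , ρ) ∷_) (rems-zip as bs (suc-injective e))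

  adds-zip : ∀ (as bs : List (Fin s)) → length as ≡ length bs →
    adds (map (λ ab → (ρ , ab)) (zip as bs)) ≡ map (λ b → (b , ρ)) bs
  adds-zip [] [] _ = refl
  adds-zip (a ∷ as) (b ∷ bs) e = cong ((b , ρ) ∷_) (adds-zip as bs (suc-injective e))

length-zip : ∀ {X Y : Set} (xs : List X) (ys : List Y) → length xs ≡ length ys → length (zip xs ys) ≡ length xs
length-zip [] [] _ = refl
length-zip (x ∷ xs) (y ∷ ys) e = cong suc (length-zip xs ys (suc-injective e))

RowIs : ∀ {s r} → Sub₂ s r → Fin r → Sub s → Set
RowIs X l A = ∀ y → X y l ≡ A y

module EdgePath {s : ℕ} (r : ℕ) (A B : Sub s) (π : Permutation′ r) (R Ad : Fin r → List (Fin s)) where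
  open CountCell s r using (mem; mem⇒∈; ∈⇒mem; mem≡false⇒∉)

  rowOf : Fin r → Fin r
  rowOf j = π ⟨$⟩ʳ j

  rowOf-injective : ∀ {j j′} → rowOf j ≡ rowOf j′ → j ≡ j′
  rowOf-injective {j} {j′} e = trans (sym (inverseˡ π)) (trans (cong (π ⟨$⟩ˡ_) e) (inverseˡ π))

  k : ℕ
  k = count (λ x → A x ∧ not (B x))

  segment : Fin r → List (Step s r)
  segment j = map (λ ab → (rowOf j , ab)) (zip (R j) (Ad j))

  path : List (Step s r)
  path = concatMap segment (allFin r)

  point : ℕ → Sub₂ s r
  point = walk (lift r A) path

  N : ℕ
  N = length path

  path-blocks : path ≡ concat (tabulate segment)
  path-blocks = cong concat (map-tabulate (λ j → j) segment)

  inRows : (Fin r → List (Fin s)) → List (Cell s r)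
  inRows L = concat (tabulate (λ j → map (λ a → (a , rowOf j)) (L j)))

  ∈-inRows⁻ : ∀ {L y l} → (y , l) ∈ inRows L → ∃ λ j → y ∈ L j × l ≡ rowOf j
  ∈-inRows⁻ {L} c∈ with ∈-concat⁻′ (tabulate (λ j → map (λ a → (a , rowOf j)) (L j))) c∈
  ... | _ , c∈j , ∈tab with ∈-tabulate⁻ ∈tab
  ... | j , refl with ∈-map⁻ (λ a → (a , rowOf j)) c∈j
  ... | y , y∈ , refl = j , y∈ , refl

  ∈-inRows⁺ : ∀ {L y} j → y ∈ L j → (y , rowOf j) ∈ inRows L
  ∈-inRows⁺ {L} j y∈ = ∈-concat⁺′ (∈-map⁺ (λ a → (a , rowOf j)) y∈) (∈-tabulate⁺ j)

  Unique-inRows : ∀ {L} → (∀ j → Unique (L j)) → Unique (inRows L)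
  Unique-inRows {L} L-unique = Unique.concat⁺
    (Allₚ.tabulate⁺ (λ j → Unique.map⁺ (λ { refl → refl }) (L-unique j)))
    (AllPairs.tabulate⁺ λ j≢j′ (c∈j , c∈j′) → j≢j′ (rowOf-injective (trans (sym (row c∈j)) (row c∈j′))))
    where
    row : ∀ {j c} → c ∈ map (λ a → (a , rowOf j)) (L j) → proj₂ c ≡ rowOf j
    row {j} c∈ with ∈-map⁻ (λ a → (a , rowOf j)) c∈
    ... | _ , _ , refl = refl

  mem-inRows : ∀ {L P Q} → (∀ j → Enumerates (L j) P Q) → ∀ y l → mem (y , l) (inRows L) ≡ P y ∧ not (Q y)
  mem-inRows {L} {P} {Q} L-enum y l with mem (y , l) (inRows L) in e
  ... | true with ∈-inRows⁻ (mem⇒∈ (inRows L) e)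
  ...   | j , y∈ , _ with Equivalence.to (proj₂ (L-enum j) y) y∈
  ...     | Py , Qy rewrite Py | Qy = refl
  mem-inRows {L} {P} {Q} L-enum y l | false with P y in eP | Q y in eQ
  ... | true | false = ⊥-elim (mem≡false⇒∉ e (subst (λ l′ → (y , l′) ∈ inRows L) (inverseʳ π)
                          (∈-inRows⁺ (π ⟨$⟩ˡ l) (Equivalence.from (proj₂ (L-enum (π ⟨$⟩ˡ l)) y) (eP , eQ)))))
  ... | true | true = refl
  ... | false | _ = refl

  module Facts (R-enum : ∀ j → Enumerates (R j) A B) (Ad-enum : ∀ j → Enumerates (Ad j) B A)
    (∣A∣≡∣B∣ : card A ≡ card B) where

    ∣R∣ : ∀ j → length (R j) ≡ k
    ∣R∣ j = length-enumeration (R-enum j)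

    ∣Ad∣ : ∀ j → length (Ad j) ≡ k
    ∣Ad∣ j = trans (length-enumeration (Ad-enum j)) (sym (count-∖-comm A B ∣A∣≡∣B∣))

    ∣R∣≡∣Ad∣ : ∀ j → length (R j) ≡ length (Ad j)
    ∣R∣≡∣Ad∣ j = trans (∣R∣ j) (sym (∣Ad∣ j))

    ∣segment∣ : ∀ j → length (segment j) ≡ k
    ∣segment∣ j = trans (length-map _ (zip (R j) (Ad j))) (trans (length-zip (R j) (Ad j) (∣R∣≡∣Ad∣ j)) (∣R∣ j))

    rems-path : rems path ≡ inRows R
    rems-path = trans (cong rems path-blocks) (trans (sym (concat-map (tabulate segment)))
      (cong concat (trans (map-tabulate segment rems)
        (tabulate-cong (λ j → rems-zip (rowOf j) (R j) (Ad j) (∣R∣≡∣Ad∣ j))))))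

    adds-path : adds path ≡ inRows Ad
    adds-path = trans (cong adds path-blocks) (trans (sym (concat-map (tabulate segment)))
      (cong concat (trans (map-tabulate segment adds)
        (tabulate-cong (λ j → adds-zip (rowOf j) (R j) (Ad j) (∣R∣≡∣Ad∣ j))))))

    mem-rems : ∀ y l → mem (y , l) (rems path) ≡ A y ∧ not (B y)
    mem-rems y l = trans (cong (mem (y , l)) rems-path) (mem-inRows R-enum y l)

    mem-adds : ∀ y l → mem (y , l) (adds path) ≡ B y ∧ not (A y)
    mem-adds y l = trans (cong (mem (y , l)) adds-path) (mem-inRows Ad-enum y l)

    private
      ∧-not-true : ∀ a b → a ∧ not b ≡ true → a ≡ true × b ≡ false
      ∧-not-true true false _ = refl , refl

    admissible : Admissible (lift r A) path
    admissible = record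
      { rems-unique = subst Unique (sym rems-path) (Unique-inRows (proj₁ ∘ R-enum))
      ; adds-unique = subst Unique (sym adds-path) (Unique-inRows (proj₁ ∘ Ad-enum))
      ; adds-disjoint = λ { {y , l} c∈adds c∈rems →
          case trans (sym (proj₂ (∧-not-true (B y) (A y) (added∈ c∈adds))))
                     (proj₁ (∧-not-true (A y) (B y) (removed∈ c∈rems))) of λ () }
      ; rems-⊆ = λ { {y , l} c∈ → proj₁ (∧-not-true (A y) (B y) (removed∈ c∈)) }
      ; adds-∩-∅ = λ { {y , l} c∈ → proj₂ (∧-not-true (B y) (A y) (added∈ c∈)) } }
      where
      removed∈ : ∀ {y l} → (y , l) ∈ rems path → A y ∧ not (B y) ≡ true
      removed∈ {y} {l} c∈ = trans (sym (mem-rems y l)) (∈⇒mem c∈)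
      added∈ : ∀ {y l} → (y , l) ∈ adds path → B y ∧ not (A y) ≡ true
      added∈ {y} {l} c∈ = trans (sym (mem-adds y l)) (∈⇒mem c∈)

    path-end : applySteps (lift r A) path ≐ lift r B
    path-end y l = begin
      applySteps (lift r A) path y l
        ≡⟨ applySteps-cell (lift r A) path (Admissible.adds-disjoint admissible) y l ⟩
      (A y ∧ not (mem (y , l) (rems path))) ∨ mem (y , l) (adds path)
        ≡⟨ cong₂ (λ a b → (A y ∧ not a) ∨ b) (mem-rems y l) (mem-adds y l) ⟩
      (A y ∧ not (A y ∧ not (B y))) ∨ (B y ∧ not (A y))
        ≡⟨ end-value (A y) (B y) ⟩
      B y ∎
      where
      open ≡-Reasoning
      end-value : ∀ a b → (a ∧ not (a ∧ not b)) ∨ (b ∧ not a) ≡ b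
      end-value true true = refl
      end-value true false = refl
      end-value false true = refl
      end-value false false = refl

    point-end : point N ≐ lift r B
    point-end y l = trans (cong (λ L → applySteps (lift r A) L y l) (take-all N path ≤-refl)) (path-end y l)

    card₂-point : ∀ p → card₂ (point p) ≡ r * card A
    card₂-point p = trans (card₂-walk path p admissible) (card₂-lift {r = r} A)

    dist-point : ∀ {p q} → p ≤ q → q ≤ N → dist (point p) (point q) ≡ (q ∸ p) + (q ∸ p)
    dist-point p≤q q≤N = dist-walk p≤q q≤N admissible

    step-row : ∀ {j st} → st ∈ segment j → proj₁ st ≡ rowOf j
    step-row {j} st∈ with ∈-map⁻ (λ ab → (rowOf j , ab)) st∈
    ... | _ , _ , refl = refl

    point-untouched : ∀ p l → (∀ j → toℕ j * k < p → rowOf j ≢ l) → RowIs (point p) l A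
    point-untouched p l misses y = applySteps-untouched (lift r A) (take p path) y l (All.tabulate miss)
      where
      miss : ∀ {st} → st ∈ take p path → proj₁ st ≢ l
      miss st∈ with ∈-take-blocks⁻ k r segment ∣segment∣ p (subst (λ L → _ ∈ take p L) path-blocks st∈)
      ... | j , st∈j , j*k<p = misses j j*k<p ∘ trans (sym (step-row st∈j))

    point-finished : ∀ p l → (∀ j → p < suc (toℕ j) * k → rowOf j ≢ l) → RowIs (point p) l B
    point-finished p l misses y = begin
      point p y l
        ≡⟨ sym (applySteps-untouched (point p) (drop p path) y l (All.tabulate miss)) ⟩
      applySteps (point p) (drop p path) y l
        ≡⟨ cong (λ X → X y l) (sym (foldl-++ stepSet (lift r A) (take p path) (drop p path))) ⟩
      applySteps (lift r A) (take p path ++ drop p path) y l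
        ≡⟨ cong (λ L → applySteps (lift r A) L y l) (take++drop≡id p path) ⟩
      applySteps (lift r A) path y l
        ≡⟨ path-end y l ⟩
      B y ∎
      where
      open ≡-Reasoning
      miss : ∀ {st} → st ∈ drop p path → proj₁ st ≢ l
      miss st∈ with ∈-drop-blocks⁻ k r segment ∣segment∣ p (subst (λ L → _ ∈ drop p L) path-blocks st∈)
      ... | j , st∈j , p<end = misses j p<end ∘ trans (sym (step-row st∈j))

    row-pending : ∀ p j → p ≤ toℕ j * k → RowIs (point p) (rowOf j) A
    row-pending p j p≤start = point-untouched p (rowOf j)
      (λ j′ j′*k<p e → <-irrefl (cong (λ i → toℕ i * k) (rowOf-injective e)) (<-≤-trans j′*k<p p≤start))

    row-done : ∀ p j → suc (toℕ j) * k ≤ p → RowIs (point p) (rowOf j) B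
    row-done p j end≤p = point-finished p (rowOf j)
      (λ j′ p<end′ e → <-irrefl (cong (λ i → suc (toℕ i) * k) (sym (rowOf-injective e))) (≤-<-trans end≤p p<end′))

    RowSettled : ℕ → Fin r → Set
    RowSettled p l = RowIs (point p) l A ⊎ RowIs (point p) l B

    -- At most one segment is in progress at any point of the path.
    row-settled : ∀ p {j j′} → j ≢ j′ → RowSettled p (rowOf j) ⊎ RowSettled p (rowOf j′)
    row-settled p {j} {j′} j≢j′ with p ≤? toℕ j * k | suc (toℕ j) * k ≤? p
    ... | yes p≤ | _ = inj₁ (inj₁ (row-pending p j p≤))
    ... | no _ | yes ≤p = inj₁ (inj₂ (row-done p j ≤p))
    ... | no p≰ | no ≰p with p ≤? toℕ j′ * k | suc (toℕ j′) * k ≤? p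
    ... | yes p≤′ | _ = inj₂ (inj₁ (row-pending p j′ p≤′))
    ... | no _ | yes ≤p′ = inj₂ (inj₂ (row-done p j′ ≤p′))
    ... | no p≰′ | no ≰p′ with <-cmp (toℕ j) (toℕ j′)
    ... | tri< j<j′ _ _ = ⊥-elim (p≰′ (≤-trans (<⇒≤ (≰⇒> ≰p)) (*-monoˡ-≤ k j<j′)))
    ... | tri≈ _ j≡j′ _ = ⊥-elim (j≢j′ (toℕ-injective j≡j′))
    ... | tri> _ _ j>j′ = ⊥-elim (p≰ (≤-trans (<⇒≤ (≰⇒> ≰p′)) (*-monoˡ-≤ k j>j′)))

-- Block-swapping permutations

InBlock : ℕ → ℕ → ℕ → Set
InBlock c w n = c ≤ n × n < c + w

inBlock? : ∀ c w n → Dec (InBlock c w n)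
inBlock? c w n = c ≤? n ×-dec n <? c + w

module BlockSwap (w c d : ℕ) where

  swap : ℕ → ℕ
  swap n with inBlock? c w n | inBlock? (c + d) w n
  ... | yes _ | _ = n + d
  ... | no _ | yes _ = n ∸ d
  ... | no _ | no _ = n

  private
    shift-in : ∀ {n} → InBlock c w n → InBlock (c + d) w (n + d)
    shift-in {n} (c≤n , n<c+w) = +-monoˡ-≤ d c≤n , subst (n + d <_) (xy∙z≈xz∙y c w d) (+-monoˡ-< d n<c+w)

    shift-out : ∀ {n} → InBlock (c + d) w n → InBlock c w (n ∸ d)
    shift-out {n} (c+d≤n , n<c+d+w) =
      subst (_≤ n ∸ d) (m+n∸n≡m c d) (∸-monoˡ-≤ d c+d≤n) ,
      subst (n ∸ d <_) (trans (cong (_∸ d) (xy∙z≈xz∙y c d w)) (m+n∸n≡m (c + w) d))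
        (∸-monoˡ-< n<c+d+w (≤-trans (m≤n+m d c) c+d≤n))

  blocks-disjoint : w ≤ d → ∀ {n} → InBlock (c + d) w n → ¬ InBlock c w n
  blocks-disjoint w≤d (c+d≤n , _) (_ , n<c+w) = <-irrefl refl (<-≤-trans n<c+w (≤-trans (+-monoʳ-≤ c w≤d) c+d≤n))

  swap-≡-first : ∀ {n} → InBlock c w n → swap n ≡ n + d
  swap-≡-first {n} n∈ with inBlock? c w n
  ... | yes _ = refl
  ... | no n∉ = ⊥-elim (n∉ n∈)

  swap-≡-second : w ≤ d → ∀ {n} → InBlock (c + d) w n → swap n ≡ n ∸ d
  swap-≡-second w≤d {n} n∈ with inBlock? c w n | inBlock? (c + d) w n
  ... | yes n∈₁ | _ = ⊥-elim (blocks-disjoint w≤d n∈ n∈₁)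
  ... | no _ | yes _ = refl
  ... | no _ | no n∉ = ⊥-elim (n∉ n∈)

  swap-outside : ∀ {n} → ¬ InBlock c w n → ¬ InBlock (c + d) w n → swap n ≡ n
  swap-outside {n} n∉₁ n∉₂ with inBlock? c w n | inBlock? (c + d) w n
  ... | yes n∈ | _ = ⊥-elim (n∉₁ n∈)
  ... | no _ | yes n∈ = ⊥-elim (n∉₂ n∈)
  ... | no _ | no _ = refl

  swap-first : ∀ {n} → InBlock c w n → InBlock (c + d) w (swap n)
  swap-first n∈ = subst (InBlock (c + d) w) (sym (swap-≡-first n∈)) (shift-in n∈)

  swap-second : w ≤ d → ∀ {n} → InBlock (c + d) w n → InBlock c w (swap n)
  swap-second w≤d n∈ = subst (InBlock c w) (sym (swap-≡-second w≤d n∈)) (shift-out n∈)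

  swap-involutive : w ≤ d → ∀ n → swap (swap n) ≡ n
  swap-involutive w≤d n with inBlock? c w n | inBlock? (c + d) w n
  ... | yes n∈ | _ = trans (swap-≡-second w≤d (shift-in n∈)) (m+n∸n≡m n d)
  ... | no _ | yes n∈ = trans (swap-≡-first (shift-out n∈)) (m∸n+n≡m (≤-trans (m≤n+m d c) (proj₁ n∈)))
  ... | no n∉₁ | no n∉₂ = swap-outside n∉₁ n∉₂

  swap-< : ∀ {r} → c + d + w ≤ r → ∀ {n} → n < r → swap n < r
  swap-< c+d+w≤r {n} n<r with inBlock? c w n | inBlock? (c + d) w n
  ... | yes n∈ | _ = <-≤-trans (proj₂ (shift-in n∈)) c+d+w≤r
  ... | no _ | yes _ = ≤-<-trans (m∸n≤m n d) n<r
  ... | no _ | no _ = n<r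

swapBlocks : ∀ r (w c d : ℕ) → Permutation′ r
swapBlocks r w c d with w ≤? d | c + d + w ≤? r
... | yes w≤d | yes fits = permutation f f involutive involutive
  where
  open BlockSwap w c d
  f : Fin r → Fin r
  f i = fromℕ< (swap-< fits (toℕ<n i))
  involutive : ∀ i → f (f i) ≡ i
  involutive i = toℕ-injective (trans (toℕ-fromℕ< _) (trans (cong swap (toℕ-fromℕ< _)) (swap-involutive w≤d (toℕ i))))
... | _ | _ = idₚ

swapBlocks-toℕ : ∀ {r w c d} → w ≤ d → c + d + w ≤ r → ∀ i →
  toℕ (swapBlocks r w c d ⟨$⟩ʳ i) ≡ BlockSwap.swap w c d (toℕ i)
swapBlocks-toℕ {r} {w} {c} {d} w≤d fits i with w ≤? d | c + d + w ≤? r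
... | yes _ | yes _ = toℕ-fromℕ< _
... | no w≰d | _ = ⊥-elim (w≰d w≤d)
... | yes _ | no unfit = ⊥-elim (unfit fits)

below-block : ∀ {c w n} → n < c → ¬ InBlock c w n
below-block n<c (c≤n , _) = <-irrefl refl (<-≤-trans n<c c≤n)

above-block : ∀ {c w n} → c + w ≤ n → ¬ InBlock c w n
above-block c+w≤n (_ , n<c+w) = <-irrefl refl (<-≤-trans n<c+w c+w≤n)

Block : ℕ → ℕ → Set
Block m n = InBlock (4 * m) 4 n

4*-suc : ∀ m → 4 * m + 4 ≡ 4 * suc m
4*-suc m = trans (+-comm (4 * m) 4) (sym (*-suc 4 m))

block-end-≤ : ∀ {m m′} → m < m′ → 4 * m + 4 ≤ 4 * m′
block-end-≤ {m} {m′} m<m′ = subst (_≤ 4 * m′) (sym (4*-suc m)) (*-monoʳ-≤ 4 m<m′)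

block-unique : ∀ {m m′ n} → Block m n → Block m′ n → m ≡ m′
block-unique {m} {m′} (m≤n , n<m) (m′≤n , n<m′) with <-cmp m m′
... | tri< m<m′ _ _ = ⊥-elim (<-irrefl refl (<-≤-trans n<m (≤-trans (block-end-≤ m<m′) m′≤n)))
... | tri≈ _ m≡m′ _ = m≡m′
... | tri> _ _ m>m′ = ⊥-elim (<-irrefl refl (<-≤-trans n<m′ (≤-trans (block-end-≤ m>m′) m≤n)))

+≤⇒≤∸ : ∀ {m n o} → m + n ≤ o → m ≤ o ∸ n
+≤⇒≤∸ {m} {n} m+n≤o = subst (_≤ _) (m+n∸n≡m m n) (∸-monoˡ-≤ n m+n≤o)

edgePermutation : ∀ r (Δ a b : ℕ) → Permutation′ r
edgePermutation r Δ a b = swapBlocks r 4 0 (4 * suc a) ∘ₚ swapBlocks r 4 (4 * suc (Δ + b)) (r ∸ 4 ∸ 4 * suc (Δ + b))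

-- For an edge u → v where v is the a-th neighbour of u and u the b-th neighbour of v, the first four
-- segments go to block suc a and the last four to block suc (Δ + b).
module EdgePermutation (r Δ : ℕ) (room : 8 * Δ + 8 ≤ r) (a b : ℕ) (a<Δ : a < Δ) (b<Δ : b < Δ) where

  head tail last : ℕ
  head = 4 * suc a
  tail = 4 * suc (Δ + b)
  last = r ∸ 4

  private
    open ≤-Reasoning

    room′ : 8 * Δ + 4 + 4 ≤ r
    room′ = subst (_≤ r) (sym (+-assoc (8 * Δ) 4 4)) room

    head+4≤tail : head + 4 ≤ tail
    head+4≤tail = block-end-≤ (s≤s (≤-trans a<Δ (m≤m+n Δ b)))

    tail+4≤last : tail + 4 ≤ last
    tail+4≤last = begin
      tail + 4               ≤⟨ block-end-≤ (s≤s (+-monoʳ-< Δ b<Δ)) ⟩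
      4 * suc (Δ + Δ)        ≡⟨ solve 1 (λ Δ → con 4 :* (con 1 :+ (Δ :+ Δ)) := con 8 :* Δ :+ con 4) refl Δ ⟩
      8 * Δ + 4              ≤⟨ +≤⇒≤∸ room′ ⟩
      last                   ∎

    last+4≡r : last + 4 ≡ r
    last+4≡r = m∸n+n≡m (≤-trans (m≤n+m 4 (8 * Δ + 4)) room′)

    tail≤last : tail ≤ last
    tail≤last = ≤-trans (m≤m+n tail 4) tail+4≤last

    4≤last∸tail : 4 ≤ last ∸ tail
    4≤last∸tail = subst (_≤ last ∸ tail) (m+n∸m≡n tail 4) (∸-monoˡ-≤ tail tail+4≤last)

    last≤r : last ≤ r
    last≤r = m∸n≤m r 4

    head-fits : 0 + head + 4 ≤ r
    head-fits = ≤-trans head+4≤tail (≤-trans tail≤last last≤r)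

    tail-fits : tail + (last ∸ tail) + 4 ≤ r
    tail-fits = ≤-reflexive (trans (cong (_+ 4) (m+[n∸m]≡n tail≤last)) last+4≡r)

    swapHead swapTail : ℕ → ℕ
    swapHead = BlockSwap.swap 4 0 head
    swapTail = BlockSwap.swap 4 tail (last ∸ tail)

    edgePermutation-toℕ : ∀ j → toℕ (edgePermutation r Δ a b ⟨$⟩ʳ j) ≡ swapTail (swapHead (toℕ j))
    edgePermutation-toℕ j = trans (swapBlocks-toℕ 4≤last∸tail tail-fits _)
      (cong swapTail (swapBlocks-toℕ (m≤m*n 4 (suc a)) head-fits j))

  head-segments : ∀ j → toℕ j < 4 → Block (suc a) (toℕ (edgePermutation r Δ a b ⟨$⟩ʳ j))
  head-segments j j<4 = subst (Block (suc a)) (sym (trans (edgePermutation-toℕ j) (swapTail-fixes n<tail))) in-head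
    where
    in-head : InBlock head 4 (swapHead (toℕ j))
    in-head = BlockSwap.swap-first 4 0 head (z≤n , j<4)
    n<tail : swapHead (toℕ j) < tail
    n<tail = <-≤-trans (proj₂ in-head) head+4≤tail
    swapTail-fixes : ∀ {n} → n < tail → swapTail n ≡ n
    swapTail-fixes n<tail = BlockSwap.swap-outside 4 tail (last ∸ tail) (below-block n<tail)
      (below-block (<-≤-trans n<tail (m≤m+n tail (last ∸ tail))))

  tail-segments : ∀ j → last ≤ toℕ j → Block (suc (Δ + b)) (toℕ (edgePermutation r Δ a b ⟨$⟩ʳ j))
  tail-segments j last≤j =
    subst (Block (suc (Δ + b))) (sym (trans (edgePermutation-toℕ j) (cong swapTail swapHead-fixes))) in-tail
    where
    in-last : InBlock (tail + (last ∸ tail)) 4 (toℕ j)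
    in-last = subst (InBlock′ (toℕ j)) (sym (m+[n∸m]≡n tail≤last))
      (last≤j , subst (toℕ j <_) (sym last+4≡r) (toℕ<n j))
      where
      InBlock′ : ℕ → ℕ → Set
      InBlock′ n c = InBlock c 4 n
    in-tail : InBlock tail 4 (swapTail (toℕ j))
    in-tail = BlockSwap.swap-second 4 tail (last ∸ tail) 4≤last∸tail in-last
    swapHead-fixes : swapHead (toℕ j) ≡ toℕ j
    swapHead-fixes = BlockSwap.swap-outside 4 0 head
      (above-block (≤-trans (≤-trans (m≤n+m 4 head) head+4≤tail) (≤-trans tail≤last last≤j)))
      (above-block (≤-trans head+4≤tail (≤-trans tail≤last last≤j)))

-- Ranks of neighbours

∧-true⁻ : ∀ a b → a ∧ b ≡ true → a ≡ true × b ≡ true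
∧-true⁻ true true _ = refl , refl

𝟙-mono : ∀ {a b} → (a ≡ true → b ≡ true) → 𝟙 a ≤ 𝟙 b
𝟙-mono {false} _ = z≤n
𝟙-mono {true} a⇒b rewrite a⇒b refl = ≤-refl

∈⇒≤-foldr-⊔ : ∀ (ns : List ℕ) {n} → n ∈ ns → n ≤ foldr _⊔_ 0 ns
∈⇒≤-foldr-⊔ (n ∷ ns) (here refl) = m≤m⊔n n _
∈⇒≤-foldr-⊔ (n ∷ ns) (there n∈) = ≤-trans (∈⇒≤-foldr-⊔ ns n∈) (m≤n⊔m n _)

degree≤maxDegree : ∀ {s} (G : LGraph s) v → degree G v ≤ maxDegree G
degree≤maxDegree G v = ∈⇒≤-foldr-⊔ _ (∈-map⁺ (degree G) (∈-allFin v))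

module Ranks {s : ℕ} (G : LGraph s) where

  precedes : Fin (m G) → Fin (m G) → Bool
  precedes x w = ⌊ toℕ x <? toℕ w ⌋

  rank : Fin (m G) → Fin (m G) → ℕ
  rank z w = count (λ x → adj G z x ∧ precedes x w)

  precedes-irrefl : ∀ w → precedes w w ≡ false
  precedes-irrefl w with toℕ w <? toℕ w
  ... | yes w<w = ⊥-elim (<-irrefl refl w<w)
  ... | no _ = refl

  rank<degree : ∀ {z w} → adj G z w ≡ true → rank z w < degree G z
  rank<degree {z} {w} z~w = ∑-mono-< (m G) fewer w w-uncounted
    where
    fewer : ∀ x → 𝟙 (adj G z x ∧ precedes x w) ≤ 𝟙 (adj G z x)
    fewer x = 𝟙-mono (λ e → ∧-true⁻ (adj G z x) _ e .proj₁)
    w-uncounted : 𝟙 (adj G z w ∧ precedes w w) < 𝟙 (adj G z w)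
    w-uncounted rewrite z~w | precedes-irrefl w = s≤s z≤n

  rank-<-mono : ∀ {z w w′} → adj G z w ≡ true → toℕ w < toℕ w′ → rank z w < rank z w′
  rank-<-mono {z} {w} {w′} z~w w<w′ = ∑-mono-< (m G) fewer w w-counted
    where
    fewer : ∀ x → 𝟙 (adj G z x ∧ precedes x w) ≤ 𝟙 (adj G z x ∧ precedes x w′)
    fewer x = 𝟙-mono (λ e → let z~x , x<w = ∧-true⁻ (adj G z x) _ e in
      cong₂ _∧_ z~x (precedes-trans x<w))
      where
      precedes-trans : precedes x w ≡ true → precedes x w′ ≡ true
      precedes-trans x<w with toℕ x <? toℕ w | toℕ x <? toℕ w′
      ... | yes _ | yes _ = refl
      ... | yes x<w | no x≮w′ = ⊥-elim (x≮w′ (<-trans x<w w<w′))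
    w-counted : 𝟙 (adj G z w ∧ precedes w w) < 𝟙 (adj G z w ∧ precedes w w′)
    w-counted rewrite z~w | precedes-irrefl w with toℕ w <? toℕ w′
    ... | yes _ = s≤s z≤n
    ... | no w≮w′ = ⊥-elim (w≮w′ w<w′)

  rank-injective : ∀ {z w w′} → adj G z w ≡ true → adj G z w′ ≡ true → rank z w ≡ rank z w′ → w ≡ w′
  rank-injective {z} {w} {w′} z~w z~w′ same with <-cmp (toℕ w) (toℕ w′)
  ... | tri< w<w′ _ _ = ⊥-elim (<-irrefl same (rank-<-mono z~w w<w′))
  ... | tri≈ _ w≡w′ _ = toℕ-injective w≡w′
  ... | tri> _ _ w>w′ = ⊥-elim (<-irrefl (sym same) (rank-<-mono z~w′ w>w′))

-- Rows shared by sets at distance 2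

Three : (Fin 4 → Set) → Set
Three P = ∃ λ t → ∃ λ t′ → ∃ λ t″ → t ≢ t′ × t ≢ t″ × t′ ≢ t″ × P t × P t′ × P t″

module _ {P : Fin 4 → Set} (pairs : ∀ {t t′} → t ≢ t′ → P t ⊎ P t′) where

  all-but : ∀ {t} → ¬ P t → ∀ {t′} → t′ ≢ t → P t′
  all-but ¬p t′≢t with pairs t′≢t
  ... | inj₁ p = p
  ... | inj₂ p = ⊥-elim (¬p p)

  three-of-four : (∀ t → Dec (P t)) → Three P
  three-of-four P? with P? 0F | P? 1F | P? 2F
  ... | no ¬p | _ | _ = 1F , 2F , 3F , (λ ()) , (λ ()) , (λ ()) , all-but ¬p (λ ()) , all-but ¬p (λ ()) , all-but ¬p (λ ())
  ... | yes p₀ | no ¬p | _ = 0F , 2F , 3F , (λ ()) , (λ ()) , (λ ()) , p₀ , all-but ¬p (λ ()) , all-but ¬p (λ ())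
  ... | yes p₀ | yes p₁ | no ¬p = 0F , 1F , 3F , (λ ()) , (λ ()) , (λ ()) , p₀ , p₁ , all-but ¬p (λ ())
  ... | yes p₀ | yes p₁ | yes p₂ = 0F , 1F , 2F , (λ ()) , (λ ()) , (λ ()) , p₀ , p₁ , p₂

module _ {s r : ℕ} where

  RowIn : Sub₂ s r → Fin r → Sub s → Sub s → Set
  RowIn Y i P Q = RowIs Y i P ⊎ RowIs Y i Q

  -- All rows of Y but at most one are P or Q.
  MostRowsIn : Sub₂ s r → Sub s → Sub s → Set
  MostRowsIn Y P Q = ∀ {i i′} → i ≢ i′ → RowIn Y i P Q ⊎ RowIn Y i′ P Q

  private
    rowIs? : ∀ (Y : Sub₂ s r) i (P : Sub s) → Dec (RowIs Y i P)
    rowIs? Y i P = all? (λ y → Y y i ≟ᵇ P y)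

    ≗? : ∀ (P Q : Sub s) → Dec (P ≗ Q)
    ≗? P Q = all? (λ y → P y ≟ᵇ Q y)

    witness : ∀ {P Q : Sub s} → ¬ P ≗ Q → ∃ λ x → P x ≢ Q x
    witness {P} {Q} P≉Q = ¬∀⟶∃¬ s _ (λ y → P y ≟ᵇ Q y) P≉Q

    differ : ∀ (X Y : Sub₂ s r) i {C P} → RowIs X i C → RowIs Y i P → ¬ C ≗ P → RowDiffer X Y i
    differ X Y i X-row Y-row C≉P with witness C≉P
    ... | x , Cx≢Px = x , λ e → Cx≢Px (trans (sym (X-row x)) (trans e (Y-row x)))

    3≰2 : ¬ 3 ≤ 2
    3≰2 (s≤s (s≤s ()))

  row-values-agree : ∀ (X Y : Sub₂ s r) {C C′ : Sub s} (i j l : Fin r) → i ≢ j → i ≢ l → j ≢ l →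
    (∀ {n} → n ≡ i ⊎ n ≡ j ⊎ n ≡ l → RowIs X n C × RowIs Y n C′) → dist X Y ≡ 2 → C ≗ C′
  row-values-agree X Y {C} {C′} i j l i≢j i≢l j≢l rows dist≡2 with ≗? C C′
  ... | yes C≗C′ = C≗C′
  ... | no C≉C′ = ⊥-elim (3≰2 (subst (3 ≤_) dist≡2 (dist-≥3 X Y i j l i≢j i≢l j≢l
          (differ′ (inj₁ refl)) (differ′ (inj₂ (inj₁ refl))) (differ′ (inj₂ (inj₂ refl))))))
    where
    differ′ : ∀ {n} → n ≡ i ⊎ n ≡ j ⊎ n ≡ l → RowDiffer X Y n
    differ′ {n} n∈ = differ X Y n (proj₁ (rows n∈)) (proj₂ (rows n∈)) C≉C′

  row-value-among : ∀ (X Y : Sub₂ s r) {C P Q : Sub s} (h : Fin 4 → Fin r) →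
    (∀ {t t′} → h t ≡ h t′ → t ≡ t′) →
    (∀ t → RowIs X (h t) C) → MostRowsIn Y P Q → dist X Y ≡ 2 → C ≗ P ⊎ C ≗ Q
  row-value-among X Y {C} {P} {Q} h h-injective X-rows Y-rows dist≡2 with ≗? C P | ≗? C Q
  ... | yes C≗P | _ = inj₁ C≗P
  ... | no _ | yes C≗Q = inj₂ C≗Q
  ... | no C≉P | no C≉Q with three-of-four (Y-rows ∘ (_∘ h-injective)) (λ t → rowIs? Y (h t) P ⊎-dec rowIs? Y (h t) Q)
  ...   | t , t′ , t″ , t≢t′ , t≢t″ , t′≢t″ , in-t , in-t′ , in-t″ =
    ⊥-elim (3≰2 (subst (3 ≤_) dist≡2 (dist-≥3 X Y (h t) (h t′) (h t″)
      (t≢t′ ∘ h-injective) (t≢t″ ∘ h-injective) (t′≢t″ ∘ h-injective)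
      (differs t in-t) (differs t′ in-t′) (differs t″ in-t″))))
    where
    differs : ∀ t → RowIn Y (h t) P Q → RowDiffer X Y (h t)
    differs t (inj₁ Y-row) = differ X Y (h t) (X-rows t) Y-row C≉P
    differs t (inj₂ Y-row) = differ X Y (h t) (X-rows t) Y-row C≉Q

-- The interpolated graph

half-2 : ∀ {n} → n + n ≡ 2 → n ≡ 1
half-2 {1} _ = refl
half-2 {suc (suc n)} e with m+n≡0⇒n≡0 n (suc-injective (suc-injective e))
... | ()

Adj′-sym : ∀ {s r} (G : LGraph s) dir ord (Π : PermChoice G r) {X Y} → Adj' G dir ord Π X Y → Adj' G dir ord Π Y X
Adj′-sym G dir ord Π (u , v , u~v , u→v , pair) = u , v , u~v , u→v , Any.map swap pair
  where
  swap : ∀ {X Y PQ} → (X ≐ proj₁ PQ × Y ≐ proj₂ PQ) ⊎ (X ≐ proj₂ PQ × Y ≐ proj₁ PQ) →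
                      (Y ≐ proj₁ PQ × X ≐ proj₂ PQ) ⊎ (Y ≐ proj₂ PQ × X ≐ proj₁ PQ)
  swap (inj₁ (X≐ , Y≐)) = inj₂ (Y≐ , X≐)
  swap (inj₂ (X≐ , Y≐)) = inj₁ (Y≐ , X≐)

-- Abstract only to keep the type checker from unfolding the block swaps when comparing paths.
abstract
  blockPermutations : ∀ {s} (G : LGraph s) (r Δ : ℕ) → PermChoice G r
  blockPermutations G r Δ u v = edgePermutation r Δ (Ranks.rank G u v) (Ranks.rank G v u)

  blockPermutations-≡ : ∀ {s} (G : LGraph s) (r Δ : ℕ) u v →
    blockPermutations G r Δ u v ≡ edgePermutation r Δ (Ranks.rank G u v) (Ranks.rank G v u)
  blockPermutations-≡ G r Δ u v = refl

module Interpolation {s : ℕ} (d r Δ : ℕ) (G : LGraph s) (spg : IsSingletonSPG d G) (Δ≡max : Δ ≡ maxDegree G)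
  (dir : Fin (m G) → Fin (m G) → Bool) (orientation : IsOrientation G dir)
  (ord : OrderChoice G r) (valid : ValidOrders G dir ord) (room : 8 * Δ + 8 ≤ r) where

  open IsSingletonSPG spg
  open Ranks G

  V : Set
  V = Fin (m G)

  Π : PermChoice G r
  Π = blockPermutations G r Δ

  vertexSet : V → Sub₂ s r
  vertexSet z = lift r (vset G z)

  Edge : V → V → Set
  Edge u v = adj G u v ≡ true × dir u v ≡ true

  module Path (u v : V) = EdgePath r (vset G u) (vset G v) (Π u v)
    (λ j → proj₁ (ord u v (Π u v) j)) (λ j → proj₂ (ord u v (Π u v) j))

  module OnPath {u v : V} (e : Edge u v) = Path.Facts u v
    (proj₁ ∘ valid u v (proj₁ e) (proj₂ e) (Π u v)) (proj₂ ∘ valid u v (proj₁ e) (proj₂ e) (Π u v))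
    (trans (dimension u) (sym (dimension v)))

  Adj : Sub₂ s r → Sub₂ s r → Set
  Adj = Adj' G dir ord Π

  data Site (X : Sub₂ s r) : Set where
    at-vertex : ∀ z → X ≐ vertexSet z → Site X
    on-edge : ∀ {u v} → Edge u v → ∀ p → p ≤ Path.N u v → X ≐ Path.point u v p → Site X

  site : ∀ {X} → InA' G dir ord Π X → Site X
  site (inj₁ (z , X≐)) = at-vertex z X≐
  site {X} (inj₂ (u , v , u~v , u→v , X∈path)) with Any-scanl⁻ stepSet (vertexSet u) (Path.path u v) X∈path
  ... | p , p≤N , X≐ = on-edge (u~v , u→v) p p≤N X≐

  card₂-site : ∀ {X} → Site X → card₂ X ≡ r * d
  card₂-site (at-vertex z X≐) = trans (card₂-cong X≐) (trans (card₂-lift {r = r} (vset G z)) (cong (r *_) (dimension z)))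
  card₂-site (on-edge {u} e p _ X≐) = trans (card₂-cong X≐) (trans (OnPath.card₂-point e p) (cong (r *_) (dimension u)))

  consecutive-adjacent : ∀ {u v X Y} → Edge u v → ∀ p → suc p ≤ Path.N u v →
    X ≐ Path.point u v p → Y ≐ Path.point u v (suc p) → Adj X Y
  consecutive-adjacent {u} {v} (u~v , u→v) p p<N X≐ Y≐ =
    u , v , u~v , u→v , Any-zip-scanl⁺ stepSet (vertexSet u) (Path.path u v) p p<N (inj₁ (X≐ , Y≐))

  adjacent-forward : ∀ {u v X Y} → Edge u v → ∀ {p q} → p ≤ q → q ≤ Path.N u v →
    X ≐ Path.point u v p → Y ≐ Path.point u v q → dist X Y ≡ 2 → Adj X Y
  adjacent-forward {u} {v} {X} {Y} e {p} {q} p≤q q≤N X≐ Y≐ dist≡2 =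
    consecutive-adjacent e p (subst (_≤ Path.N u v) q≡1+p q≤N) X≐ (subst (λ n → Y ≐ Path.point u v n) q≡1+p Y≐)
    where
    q≡1+p : q ≡ suc p
    q≡1+p = trans (sym (m∸n+n≡m p≤q))
      (cong (_+ p) (half-2 (trans (sym (OnPath.dist-point e p≤q q≤N)) (trans (sym (dist-cong X≐ Y≐)) dist≡2))))

  adjacent-on-path : ∀ {u v X Y} → Edge u v → ∀ {p q} → p ≤ Path.N u v → q ≤ Path.N u v →
    X ≐ Path.point u v p → Y ≐ Path.point u v q → dist X Y ≡ 2 → Adj X Y
  adjacent-on-path {X = X} {Y} e {p} {q} p≤N q≤N X≐ Y≐ dist≡2 with ≤-total p q
  ... | inj₁ p≤q = adjacent-forward e p≤q q≤N X≐ Y≐ dist≡2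
  ... | inj₂ q≤p = Adj′-sym G dir ord Π (adjacent-forward e q≤p p≤N Y≐ X≐ (trans (dist-sym Y X) dist≡2))

  adj-sym : ∀ {u v} → adj G u v ≡ true → adj G v u ≡ true
  adj-sym {u} {v} u~v = trans (symmetric v u) u~v

  rank<Δ : ∀ {z w} → adj G z w ≡ true → rank z w < Δ
  rank<Δ {z} z~w = <-≤-trans (rank<degree z~w) (subst (degree G z ≤_) (sym Δ≡max) (degree≤maxDegree G z))

  module Rows {u v : V} (e : Edge u v) where
    open EdgePermutation r Δ room (rank u v) (rank v u) (rank<Δ (proj₁ e)) (rank<Δ (adj-sym (proj₁ e)))

    head-rows : ∀ j → toℕ j < 4 → Block (suc (rank u v)) (toℕ (Path.rowOf u v j))
    head-rows j j<4 = subst (λ π → Block (suc (rank u v)) (toℕ (π ⟨$⟩ʳ j)))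
      (sym (blockPermutations-≡ G r Δ u v)) (head-segments j j<4)

    tail-rows : ∀ j → r ∸ 4 ≤ toℕ j → Block (suc (Δ + rank v u)) (toℕ (Path.rowOf u v j))
    tail-rows j last≤j = subst (λ π → Block (suc (Δ + rank v u)) (toℕ (π ⟨$⟩ʳ j)))
      (sym (blockPermutations-≡ G r Δ u v)) (tail-segments j last≤j)

  adjacent-to-start : ∀ {z v X Y} → Edge z v → ∀ {q} → q ≤ Path.N z v →
    X ≐ vertexSet z → Y ≐ Path.point z v q → dist X Y ≡ 2 → Adj X Y
  adjacent-to-start e q≤N X≐ = adjacent-on-path e z≤n q≤N X≐

  adjacent-to-end : ∀ {w z X Y} → Edge w z → ∀ {q} → q ≤ Path.N w z →
    X ≐ vertexSet z → Y ≐ Path.point w z q → dist X Y ≡ 2 → Adj X Y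
  adjacent-to-end e q≤N X≐ = adjacent-on-path e ≤-refl q≤N (≐-trans X≐ (≐-sym (OnPath.point-end e)))

  data Near (X : Sub₂ s r) (z : V) : Set where
    at-vertex : X ≐ vertexSet z → Near X z
    leaving : ∀ {v} → Edge z v → ∀ p → p ≤ Path.N z v → p ≤ 4 * Path.k z v → X ≐ Path.point z v p → Near X z
    entering : ∀ {w} → Edge w z → ∀ p → p ≤ Path.N w z → (r ∸ 4) * Path.k w z ≤ p → X ≐ Path.point w z p → Near X z

  nearBlock : ∀ {X z} → Near X z → ℕ
  nearBlock (at-vertex _) = 0
  nearBlock {z = z} (leaving {v} _ _ _ _ _) = suc (rank z v)
  nearBlock {z = z} (entering {w} _ _ _ _ _) = suc (Δ + rank z w)

  nearBlock≤ : ∀ {X z} (n : Near X z) → nearBlock n ≤ Δ + Δ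
  nearBlock≤ (at-vertex _) = z≤n
  nearBlock≤ (leaving e _ _ _ _) = ≤-trans (rank<Δ (proj₁ e)) (m≤m+n _ _)
  nearBlock≤ (entering e _ _ _ _) = subst (_≤ Δ + Δ) (+-suc Δ _) (+-monoʳ-≤ Δ (rank<Δ (adj-sym (proj₁ e))))

  near-outside : ∀ {X z} (n : Near X z) l → ¬ Block (nearBlock n) (toℕ l) → RowIs X l (vset G z)
  near-outside (at-vertex X≐) l _ y = X≐ y l
  near-outside (leaving {v} e p _ p≤4k X≐) l l∉ y = trans (X≐ y l) (OnPath.point-untouched e p l started y)
    where
    started : ∀ j → toℕ j * Path.k _ v < p → Path.rowOf _ v j ≢ l
    started j j*k<p refl = l∉ (Rows.head-rows e j (*-cancelʳ-< (Path.k _ v) (toℕ j) 4 (<-≤-trans j*k<p p≤4k)))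
  near-outside (entering {w} e p _ last≤p X≐) l l∉ y = trans (X≐ y l) (OnPath.point-finished e p l unfinished y)
    where
    unfinished : ∀ j → p < suc (toℕ j) * Path.k w _ → Path.rowOf w _ j ≢ l
    unfinished j p<end refl = l∉ (Rows.tail-rows e j
      (m<1+n⇒m≤n (*-cancelʳ-< (Path.k w _) (r ∸ 4) (suc (toℕ j)) (≤-<-trans last≤p p<end))))

  near-dist : ∀ {X z} → Near X z → ∃ λ t → dist X (vertexSet z) ≡ t + t
  near-dist {z = z} (at-vertex X≐) = 0 , trans (dist-cong X≐ (λ _ _ → refl)) (dist-self (vertexSet z))
  near-dist {X} {z} (leaving {v} e p p≤N _ X≐) =
    p , trans (dist-cong X≐ (λ _ _ → refl))
              (trans (dist-sym (Path.point z v p) (Path.point z v 0)) (OnPath.dist-point e z≤n p≤N))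
  near-dist (entering {w} e p p≤N _ X≐) =
    Path.N w _ ∸ p , trans (dist-cong X≐ (≐-sym (OnPath.point-end e))) (OnPath.dist-point e p≤N ≤-refl)

  adjacent-to-vertex : ∀ {X Y z} → X ≐ vertexSet z → Near Y z → dist X Y ≡ 2 → Adj X Y
  adjacent-to-vertex {z = z} X≐ (at-vertex Y≐) dist≡2 =
    case trans (sym dist≡2) (trans (dist-cong X≐ Y≐) (dist-self (vertexSet z))) of λ ()
  adjacent-to-vertex X≐ (leaving e _ q≤N _ Y≐) = adjacent-to-start e q≤N X≐ Y≐
  adjacent-to-vertex X≐ (entering e _ q≤N _ Y≐) = adjacent-to-end e q≤N X≐ Y≐

  split-adjacent : ∀ {X Y z} (nx : Near X z) (ny : Near Y z) → nearBlock nx ≢ nearBlock ny → dist X Y ≡ 2 → Adj X Y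
  split-adjacent {X} {Y} {z} nx ny blocks≢ dist≡2 with near-dist nx | near-dist ny
  ... | t , dX | t′ , dY with one-is-zero t t′ (trans (sym (cong₂ _+_ dX dY)) (trans (sym via-z) dist≡2))
    where
    via-z : dist X Y ≡ dist X (vertexSet z) + dist Y (vertexSet z)
    via-z = dist-via X Y (vertexSet z) λ x i → case inBlock? (4 * nearBlock nx) 4 (toℕ i) of λ where
      (yes i∈) → inj₂ (near-outside ny i (blocks≢ ∘ block-unique i∈) x)
      (no i∉) → inj₁ (near-outside nx i i∉ x)
    one-is-zero : ∀ a b → (a + a) + (b + b) ≡ 2 → a ≡ 0 ⊎ b ≡ 0
    one-is-zero zero b _ = inj₁ refl
    one-is-zero (suc a) zero _ = inj₂ refl
    one-is-zero (suc a) (suc b) e with m+n≡0⇒n≡0 (a + a)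
      (suc-injective (trans (cong (_+ (suc b + suc b)) (sym (+-suc a a))) (suc-injective e)))
    ... | ()
  ... | inj₁ refl = adjacent-to-vertex (dist≡0⇒≐ X (vertexSet z) dX) ny dist≡2
  ... | inj₂ refl =
    Adj′-sym G dir ord Π (adjacent-to-vertex (dist≡0⇒≐ Y (vertexSet z) dY) nx (trans (dist-sym Y X) dist≡2))

  near-adjacent : ∀ {X Y z} → Near X z → Near Y z → dist X Y ≡ 2 → Adj X Y
  near-adjacent (at-vertex X≐) ny = adjacent-to-vertex X≐ ny
  near-adjacent {X} {Y} nx (at-vertex Y≐) dist≡2 =
    Adj′-sym G dir ord Π (adjacent-to-vertex Y≐ nx (trans (dist-sym Y X) dist≡2))
  near-adjacent {z = z} nx@(leaving {v} e p p≤N _ X≐) ny@(leaving {v′} e′ q q≤N _ Y≐) with v ≟ᶠ v′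
  ... | yes refl = adjacent-on-path e p≤N q≤N X≐ Y≐
  ... | no v≢v′ = split-adjacent nx ny (v≢v′ ∘ rank-injective (proj₁ e) (proj₁ e′) ∘ suc-injective)
  near-adjacent nx@(leaving e _ _ _ _) ny@(entering _ _ _ _ _) =
    split-adjacent nx ny (λ same → <-irrefl same (s≤s (≤-trans (rank<Δ (proj₁ e)) (m≤m+n _ _))))
  near-adjacent nx@(entering _ _ _ _ _) ny@(leaving e _ _ _ _) =
    split-adjacent nx ny (λ same → <-irrefl (sym same) (s≤s (≤-trans (rank<Δ (proj₁ e)) (m≤m+n _ _))))
  near-adjacent {z = z} nx@(entering {w} e p p≤N _ X≐) ny@(entering {w′} e′ q q≤N _ Y≐) with w ≟ᶠ w′
  ... | yes refl = adjacent-on-path e p≤N q≤N X≐ Y≐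
  ... | no w≢w′ = split-adjacent nx ny
    (w≢w′ ∘ rank-injective (adj-sym (proj₁ e)) (adj-sym (proj₁ e′)) ∘ +-cancelˡ-≡ Δ _ _ ∘ suc-injective)

  private
    free : ℕ
    free = 4 * suc (Δ + Δ)

    free+2<r : free + 2 < r
    free+2<r = ≤-trans
      (≤-reflexive (solve 1 (λ Δ → con 1 :+ (con 4 :* (con 1 :+ (Δ :+ Δ)) :+ con 2) := con 8 :* Δ :+ con 7) refl Δ))
      (≤-trans (+-monoʳ-≤ (8 * Δ) (n≤1+n 7)) room)

    freeRow : ∀ t → t ≤ 2 → Fin r
    freeRow t t≤2 = fromℕ< (≤-<-trans (+-monoʳ-≤ free t≤2) free+2<r)

    freeRow-injective : ∀ {t t′} t≤2 t′≤2 → freeRow t t≤2 ≡ freeRow t′ t′≤2 → t ≡ t′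
    freeRow-injective t≤2 t′≤2 e =
      +-cancelˡ-≡ free _ _ (trans (sym (toℕ-fromℕ< _)) (trans (cong toℕ e) (toℕ-fromℕ< _)))

    outside-near-blocks : ∀ {X z} (n : Near X z) t t≤2 → ¬ Block (nearBlock n) (toℕ (freeRow t t≤2))
    outside-near-blocks n t t≤2 = above-block (subst (_≤ toℕ (freeRow t t≤2)) (sym (4*-suc (nearBlock n)))
      (≤-trans (*-monoʳ-≤ 4 (s≤s (nearBlock≤ n))) (subst (free ≤_) (sym (toℕ-fromℕ< _)) (m≤m+n free t))))

  near-same-vertex : ∀ {X Y z z′} → Near X z → Near Y z′ → dist X Y ≡ 2 → z ≡ z′
  near-same-vertex {X} {Y} {z} {z′} nx ny dist≡2 = distinct z z′
    (row-values-agree X Y (freeRow 0 z≤n) (freeRow 1 (s≤s z≤n)) (freeRow 2 ≤-refl)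
      (λ e → case freeRow-injective {0} {1} z≤n (s≤s z≤n) e of λ ())
      (λ e → case freeRow-injective {0} {2} z≤n ≤-refl e of λ ())
      (λ e → case freeRow-injective {1} {2} (s≤s z≤n) ≤-refl e of λ ()) rows dist≡2)
    where
    rows : ∀ {n} → n ≡ freeRow 0 z≤n ⊎ n ≡ freeRow 1 (s≤s z≤n) ⊎ n ≡ freeRow 2 ≤-refl →
      RowIs X n (vset G z) × RowIs Y n (vset G z′)
    rows {n} n∈ = near-outside nx n (outside n∈ nx) , near-outside ny n (outside n∈ ny)
      where
      outside : ∀ {Z w} → n ≡ freeRow 0 z≤n ⊎ n ≡ freeRow 1 (s≤s z≤n) ⊎ n ≡ freeRow 2 ≤-refl →
        (nz : Near Z w) → ¬ Block (nearBlock nz) (toℕ n)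
      outside (inj₁ refl) nz = outside-near-blocks nz 0 z≤n
      outside (inj₂ (inj₁ refl)) nz = outside-near-blocks nz 1 (s≤s z≤n)
      outside (inj₂ (inj₂ refl)) nz = outside-near-blocks nz 2 ≤-refl

  record Far (X : Sub₂ s r) : Set where
    constructor far
    field
      {from to} : V
      edge : Edge from to
      p : ℕ
      p≤N : p ≤ Path.N from to
      head-done : 4 * Path.k from to < p
      tail-pending : p < (r ∸ 4) * Path.k from to
      X≐ : X ≐ Path.point from to p

  classify : ∀ {X} → Site X → (∃ λ z → Near X z) ⊎ Far X
  classify (at-vertex z X≐) = inj₁ (z , at-vertex X≐)
  classify (on-edge {u} {v} e p p≤N X≐) with p ≤? 4 * Path.k u v | (r ∸ 4) * Path.k u v ≤? p
  ... | yes p≤ | _ = inj₁ (u , leaving e p p≤N p≤ X≐)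
  ... | no _ | yes ≤p = inj₁ (v , entering e p p≤N ≤p X≐)
  ... | no p≰ | no ≰p = inj₂ (far e p p≤N (≰⇒> p≰) (≰⇒> ≰p) X≐)

  ends : ∀ {Y} → Site Y → V × V
  ends (at-vertex z _) = z , z
  ends (on-edge {u} {v} _ _ _ _) = u , v

  settled⇒row-in : ∀ {u v Y} (e : Edge u v) q → Y ≐ Path.point u v q → ∀ l →
    OnPath.RowSettled e q (Path.rowOf u v (Π u v ⟨$⟩ˡ l)) → RowIn Y l (vset G u) (vset G v)
  settled⇒row-in {u} {v} {Y} e q Y≐ l = ⊎-map (transport (vset G u)) (transport (vset G v))
    where
    transport : ∀ C → RowIs (Path.point u v q) (Path.rowOf u v (Π u v ⟨$⟩ˡ l)) C → RowIs Y l C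
    transport C row y = trans (Y≐ y l) (subst (λ l′ → Path.point u v q y l′ ≡ C y) (inverseʳ (Π u v)) (row y))

  site-rows : ∀ {Y} (σ : Site Y) → MostRowsIn Y (vset G (proj₁ (ends σ))) (vset G (proj₂ (ends σ)))
  site-rows (at-vertex z Y≐) _ = inj₁ (inj₁ (λ y → Y≐ y _))
  site-rows {Y} (on-edge {u} {v} e q _ Y≐) {i} {i′} i≢i′ =
    ⊎-map (settled⇒row-in e q Y≐ i) (settled⇒row-in e q Y≐ i′)
      (OnPath.row-settled e q {Π u v ⟨$⟩ˡ i} {Π u v ⟨$⟩ˡ i′} (i≢i′ ∘ unrow))
    where
    unrow : Π u v ⟨$⟩ˡ i ≡ Π u v ⟨$⟩ˡ i′ → i ≡ i′
    unrow same = trans (sym (inverseʳ (Π u v))) (trans (cong (Π u v ⟨$⟩ʳ_) same) (inverseʳ (Π u v)))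

  loop-free : ∀ {u v} → adj G u v ≡ true → ¬ (vset G u ≗ vset G v)
  loop-free {u} u~v u≗v with distinct u _ u≗v
  ... | refl = case trans (sym u~v) (irreflexive u) of λ ()

  private
    8≤r : 8 ≤ r
    8≤r = ≤-trans (m≤n+m 8 (8 * Δ)) room

    headSegment : Fin 4 → Fin r
    headSegment t = fromℕ< (<-≤-trans (toℕ<n t) (≤-trans (m≤n+m 4 4) 8≤r))

    tailSegment : Fin 4 → Fin r
    tailSegment t = fromℕ< (subst (r ∸ 4 + toℕ t <_) (r∸4+4≡r) (+-monoʳ-< (r ∸ 4) (toℕ<n t)))
      where
      r∸4+4≡r : r ∸ 4 + 4 ≡ r
      r∸4+4≡r = m∸n+n≡m (≤-trans (m≤n+m 4 4) 8≤r)

    segments-injective : ∀ (seg : Fin 4 → Fin r) → (∀ t → toℕ (seg t) ≡ toℕ (seg 0F) + toℕ t) →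
      ∀ {t t′} → seg t ≡ seg t′ → t ≡ t′
    segments-injective seg offset {t} {t′} e = toℕ-injective (+-cancelˡ-≡ (toℕ (seg 0F)) _ _
      (trans (sym (offset t)) (trans (cong toℕ e) (offset t′))))

  far-adjacent : ∀ {X Y} → Far X → Site Y → dist X Y ≡ 2 → Adj X Y
  far-adjacent {X} {Y} (far {u} {v} e p p≤N head-done tail-pending X≐) σ dist≡2 =
    conclude σ (row-value-among X Y headRow headRow-injective head-rows (site-rows σ) dist≡2)
               (row-value-among X Y tailRow tailRow-injective tail-rows (site-rows σ) dist≡2)
    where
    headRow tailRow : Fin 4 → Fin r
    headRow = Path.rowOf u v ∘ headSegment
    tailRow = Path.rowOf u v ∘ tailSegment
    headRow-injective : ∀ {t t′} → headRow t ≡ headRow t′ → t ≡ t′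
    headRow-injective = segments-injective headSegment
      (λ t → trans (toℕ-fromℕ< _) (cong (_+ toℕ t) (sym (toℕ-fromℕ< _)))) ∘ Path.rowOf-injective u v
    tailRow-injective : ∀ {t t′} → tailRow t ≡ tailRow t′ → t ≡ t′
    tailRow-injective = segments-injective tailSegment (λ t → trans (toℕ-fromℕ< _)
      (cong (_+ toℕ t) (sym (trans (toℕ-fromℕ< _) (+-identityʳ (r ∸ 4)))))) ∘ Path.rowOf-injective u v
    head-rows : ∀ t → RowIs X (headRow t) (vset G v)
    head-rows t y = trans (X≐ y _) (OnPath.row-done e p (headSegment t) (<⇒≤ (≤-<-trans
      (*-monoˡ-≤ (Path.k u v) (subst (_≤ 4) (sym (cong suc (toℕ-fromℕ< _))) (toℕ<n t))) head-done)) y)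
    tail-rows : ∀ t → RowIs X (tailRow t) (vset G u)
    tail-rows t y = trans (X≐ y _) (OnPath.row-pending e p (tailSegment t) (<⇒≤ (<-≤-trans tail-pending
      (*-monoˡ-≤ (Path.k u v) (subst (r ∸ 4 ≤_) (sym (toℕ-fromℕ< _)) (m≤m+n (r ∸ 4) (toℕ t)))))) y)
    ends-differ : ∀ {C} → vset G u ≗ C → vset G v ≗ C → ⊥
    ends-differ u≗C v≗C = loop-free (proj₁ e) (λ y → trans (u≗C y) (sym (v≗C y)))
    conclude : (σ : Site Y) → let (a , b) = ends σ in
      vset G v ≗ vset G a ⊎ vset G v ≗ vset G b → vset G u ≗ vset G a ⊎ vset G u ≗ vset G b → Adj X Y
    conclude (at-vertex z _) v≗z u≗z = ⊥-elim (ends-differ (reduce u≗z) (reduce v≗z))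
    conclude (on-edge e′ q q≤N Y≐) (inj₁ v≗w) (inj₁ u≗w) = ⊥-elim (ends-differ u≗w v≗w)
    conclude (on-edge e′ q q≤N Y≐) (inj₂ v≗x) (inj₂ u≗x) = ⊥-elim (ends-differ u≗x v≗x)
    conclude (on-edge {w} {x} e′ q q≤N Y≐) (inj₂ v≗x) (inj₁ u≗w) with distinct u w u≗w | distinct v x v≗x
    ... | refl | refl = adjacent-on-path e p≤N q≤N X≐ Y≐ dist≡2
    conclude (on-edge {w} {x} e′ q q≤N Y≐) (inj₁ v≗w) (inj₂ u≗x) with distinct u x u≗x | distinct v w v≗w
    ... | refl | refl = case trans (sym (proj₂ e′)) (Equivalence.to (orientation u v (proj₁ e)) (proj₂ e)) of λ ()

  adjacent : ∀ {X Y} → Site X → Site Y → dist X Y ≡ 2 → Adj X Y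
  adjacent {X} {Y} σ τ dist≡2 = by-kind (classify σ) (classify τ)
    where
    by-kind : (∃ λ z → Near X z) ⊎ Far X → (∃ λ z → Near Y z) ⊎ Far Y → Adj X Y
    by-kind (inj₂ fx) _ = far-adjacent fx τ dist≡2
    by-kind (inj₁ _) (inj₂ fy) = Adj′-sym G dir ord Π (far-adjacent fy σ (trans (dist-sym Y X) dist≡2))
    by-kind (inj₁ (z , nx)) (inj₁ (z′ , ny)) =
      near-adjacent nx (subst (Near Y) (sym (near-same-vertex nx ny dist≡2)) ny) dist≡2

  sets-meeting-in-rd-1-are-adjacent : ∀ X Y → InA' G dir ord Π X → InA' G dir ord Π Y →
    card₂ (X ∩₂ Y) + 1 ≡ r * d → Adj X Y
  sets-meeting-in-rd-1-are-adjacent X Y X∈ Y∈ ∣X∩Y∣ =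
    adjacent (site X∈) (site Y∈) (dist≡2 {X = X} {Y = Y} (card₂-site (site X∈)) (card₂-site (site Y∈)) ∣X∩Y∣)

-- Without edges a connected graph has a single vertex, so 𝒜′ has a single set and the claim is vacuous.
edgeless-case : ∀ {s} (d r : ℕ) (G : LGraph s) → IsSingletonSPG d G → 0 ≡ maxDegree G →
  (dir : Fin (m G) → Fin (m G) → Bool) (ord : OrderChoice G r) (Π : PermChoice G r) →
  ∀ X Y → InA' G dir ord Π X → InA' G dir ord Π Y → card₂ (X ∩₂ Y) + 1 ≡ r * d → Adj' G dir ord Π X Y
edgeless-case {s} d r G spg 0≡max dir ord Π X Y X∈ Y∈ ∣X∩Y∣ = ⊥-elim (single-set X∈ Y∈)
  where
  open IsSingletonSPG spg
  no-edge : ∀ {u v} → adj G u v ≡ true → ⊥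
  no-edge {u} u~v = <-irrefl refl (<-≤-trans (≤-<-trans z≤n (Ranks.rank<degree G u~v))
    (subst (degree G u ≤_) (sym 0≡max) (degree≤maxDegree G u)))
  card₂-vertex : ∀ {Z} z → Z ≐ lift r (vset G z) → card₂ Z ≡ r * d
  card₂-vertex z Z≐ = trans (card₂-cong Z≐) (trans (card₂-lift {r = r} (vset G z)) (cong (r *_) (dimension z)))
  single-set : InA' G dir ord Π X → InA' G dir ord Π Y → ⊥
  single-set (inj₂ (_ , _ , u~v , _)) _ = no-edge u~v
  single-set (inj₁ _) (inj₂ (_ , _ , u~v , _)) = no-edge u~v
  single-set (inj₁ (u , X≐)) (inj₁ (w , Y≐)) = same-vertex (connected u w) Y≐
    where
    same-vertex : ∀ {w′} → Reach G u w′ → Y ≐ lift r (vset G w′) → ⊥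
    same-vertex (step u~v _) _ = no-edge u~v
    same-vertex here Y≐′ =
      case trans (sym (dist≡2 {X = X} {Y = Y} (card₂-vertex u X≐) (card₂-vertex u Y≐′) ∣X∩Y∣))
                 (trans (dist-cong X≐ Y≐′) (dist-self (lift r (vset G u)))) of λ ()

n!≤Tn : ∀ n → n ! ≤ T n
n!≤Tn zero = ≤-refl
n!≤Tn (suc n) = ≤-trans (*-monoʳ-≤ (suc n) (n!≤Tn n)) (m≤m+n (suc n * T n) 1)

-- Every bound u n = (n T n + 1)/(n n!) exceeds 1.
CeilBound⇒16Δ≤r : ∀ {r Δ} → CeilBound r Δ → 16 * Δ ≤ r
CeilBound⇒16Δ≤r {r} {Δ} (suc n , _ , bound) =
  *-cancelʳ-≤ (16 * Δ) r (suc n * suc n !) {{m*n≢0 (suc n) (suc n !) {{_}} {{suc n !≢0}}}}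
    (≤-trans (*-monoʳ-≤ (16 * Δ) (≤-trans (*-monoʳ-≤ (suc n) (n!≤Tn (suc n))) (m≤m+n _ 1))) bound)

mainTheorem3 : ∀ {s : ℕ} (d r Δ : ℕ) (G : LGraph s) →
    IsSingletonSPG d G →
    Δ ≡ maxDegree G →
    CeilBound r Δ →
    (dir : Fin (m G) → Fin (m G) → Bool) → IsOrientation G dir →
    (ord : OrderChoice G r) → ValidOrders G dir ord →
    Σ (PermChoice G r) λ Π →
      ∀ (X Y : Sub₂ s r) → InA' G dir ord Π X → InA' G dir ord Π Y →
        card₂ (X ∩₂ Y) + 1 ≡ r * d → Adj' G dir ord Π X Y
mainTheorem3 d r zero G spg 0≡max _ dir _ ord _ =
  blockPermutations G r 0 , edgeless-case d r G spg 0≡max dir ord (blockPermutations G r 0)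
mainTheorem3 d r Δ@(suc Δ′) G spg Δ≡max bound dir orientation ord valid =
  blockPermutations G r Δ ,
  Interpolation.sets-meeting-in-rd-1-are-adjacent d r Δ G spg Δ≡max dir orientation ord valid room
  where
  room : 8 * Δ + 8 ≤ r
  room = ≤-trans (+-monoʳ-≤ (8 * Δ) (*-monoʳ-≤ 8 (s≤s z≤n)))
           (subst (_≤ r) (*-distribʳ-+ Δ 8 8) (CeilBound⇒16Δ≤r {r} {Δ} bound))
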